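{- Let $p$ be a prime, $r\in\mathbb{Z}$, $r_0\in\mathbb{F}_p$ with $r\equiv r_0\pmod p$, and $n\geq 2$. If the polynomial $x^n-r_0$ is irreducible in $\mathbb{F}_p[x]$, then the equation $D^r_n(x_0,\ldots,x_{n-1})=p$ has no solution $(x_0,\ldots,x_{n-1})\in\mathbb{Z}^n$. In particular, if $q$ is a prime and $x^q\equiv r\pmod p$ has no solution, then $D^r_q(x_0,\ldots,x_{q-1})=p$ has no solution in the integers.
   Context: For $r\in\mathbb{Z}$, a positive integer $n$ and $\bar x=(x_0,\ldots,x_{n-1})\in\mathbb{Z}^n$, let $M^r_n(\bar x)$ be the $n\times n$ matrix whose $(i,j)$ entry ($0\le i,j<n$) is $x_{i-j}$ if $i\ge j$ and $r\,x_{n+i-j}$ if $i<j$, and $D^r_n(\bar x)=\det M^r_n(\bar x)$ (the norm of $x_0+x_1u+\cdots+x_{n-1}u^{n-1}$ in $\mathbb{Z}[x]/(x^n-r)$, $u=x\bmod(x^n-r)$). -}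

module Defs where

open import Data.Nat as ℕ using (ℕ; zero; suc; _∸_; _≤?_; _<?_)
open import Data.Integer as ℤ using (ℤ; +_; -_; _+_; _-_; _*_)
open import Data.Integer.Divisibility using (_∣_)
open import Data.Fin using (Fin; toℕ; fromℕ<; punchIn) renaming (zero to fz; suc to fs)
open import Data.List using (List; []; _∷_; replicate; _++_)
open import Data.Product using (∃; _×_)
open import Relation.Nullary using (¬_; yes; no)

sumFin : ∀ n → (Fin n → ℤ) → ℤ
sumFin zero    f = + 0
sumFin (suc n) f = f fz + sumFin n (λ j → f (fs j))

sign : ℕ → ℤ
sign zero    = + 1
sign (suc k) = - sign k

det : ∀ n → (Fin n → Fin n → ℤ) → ℤ
det zero    A = + 1
det (suc n) A =
  sumFin (suc n) (λ j → sign (toℕ j) * A fz j * det n (λ i k → A (fs i) (punchIn j k)))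

-- x_k for k : ℕ (k < n always holds where used; 0 otherwise)
at : ∀ {n} → (Fin n → ℤ) → ℕ → ℤ
at {n} x k with k <? n
... | yes k<n = x (fromℕ< k<n)
... | no  _   = + 0

M : (r : ℤ) (n : ℕ) → (Fin n → ℤ) → Fin n → Fin n → ℤ
M r n x i j with toℕ j ≤? toℕ i
... | yes _ = at x (toℕ i ∸ toℕ j)
... | no  _ = r * at x ((n ℕ.+ toℕ i) ∸ toℕ j)

D : (r : ℤ) (n : ℕ) → (Fin n → ℤ) → ℤ
D r n x = det n (M r n x)

-- Polynomials over F_p, represented by integer coefficient lists
-- (lowest degree first) taken modulo p.

Poly : Set
Poly = List ℤ

coeff : Poly → ℕ → ℤ
coeff []       k       = + 0
coeff (a ∷ f)  zero    = a
coeff (a ∷ f)  (suc k) = coeff f k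

_+P_ : Poly → Poly → Poly
[]      +P g       = g
f       +P []      = f
(a ∷ f) +P (b ∷ g) = (a + b) ∷ (f +P g)

scale : ℤ → Poly → Poly
scale c []      = []
scale c (a ∷ f) = (c * a) ∷ scale c f

_*P_ : Poly → Poly → Poly
[]      *P g = []
(a ∷ f) *P g = scale a g +P (+ 0 ∷ (f *P g))

_≈P_[mod_] : Poly → Poly → ℕ → Set
f ≈P g [mod p ] = ∀ k → (+ p) ∣ (coeff f k - coeff g k)

NonConstMod : ℕ → Poly → Set
NonConstMod p f = ∃ λ k → (1 ℕ.≤ k) × ¬ ((+ p) ∣ coeff f k)

-- irreducible in F_p[x] (p prime): not a unit or zero (i.e. non-constant)
-- and not a product of two non-units (non-units among nonzero factors
-- are exactly the non-constant polynomials).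
IrreducibleMod : ℕ → Poly → Set
IrreducibleMod p f =
  NonConstMod p f ×
  (∀ g h → (g *P h) ≈P f [mod p ] → ¬ (NonConstMod p g × NonConstMod p h))

xⁿ-c : ℕ → ℤ → Poly
xⁿ-c n c = (replicate n (+ 0) ++ (+ 1 ∷ [])) +P (- c ∷ [])

-- D^r_n(x) is the determinant of the matrix M of multiplication by α = x₀ + x₁ u + ⋯ + x_{n-1} u^{n-1}
-- on ℤ[u] = ℤ[x]/(xⁿ - r). Suppose D = p. If p divides every xᵢ then pⁿ divides D, impossible for
-- n ≥ 2. Otherwise p ∣ det M gives a vector v ≢ 0 (mod p) with M v ≡ 0 (mod p), i.e. α v = 0 in
-- 𝔽ₚ[x]/(xⁿ - r₀) with α and v nonzero of degree < n; but this ring has no zero divisors, as xⁿ - r₀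
-- is irreducible.
-- For the second statement, a factor g of x^q - r over 𝔽ₚ of degree d with 0 < d < q would give, via
-- the companion matrix C of g, C^q ≡ r I and hence (det C)^q ≡ r^d; as gcd(d, q) = 1, r would be a
-- q-th power modulo p.

module Submission where

open import Defs
open import Data.Bool using (if_then_else_; true; false)
open import Data.Empty using (⊥; ⊥-elim)
open import Data.Fin using (Fin; toℕ; fromℕ; fromℕ<; inject₁; lower₁; punchIn; punchOut)
  renaming (zero to fz; suc to fs)
open import Data.Fin.Properties
  using ( _≟_; any?; inject₁-lower₁; punchInᵢ≢i; punchOut-cong; punchOut-punchIn; suc-injective
        ; toℕ<n; toℕ-fromℕ; toℕ-fromℕ<; toℕ-injective; toℕ-lower₁)
open import Data.Integer as ℤ using (ℤ; +_; -_; _+_; _-_; _*_; _^_)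
open import Data.Integer.Divisibility using (_∣_)
open import Data.Integer.Divisibility.Signed as S
  using (divides; ∣m∣n⇒∣m+n; ∣m∣n⇒∣m-n; ∣m⇒∣-m; ∣n⇒∣m*n; ∣m⇒∣m*n; ∣-refl; ∣ᵤ⇒∣; ∣⇒∣ᵤ)
open import Data.Integer.Properties as ℤ using ()
open import Data.Integer.Tactic.RingSolver using (solve-∀)
open import Data.List using ([]; _∷_; replicate; _++_; length; drop)
open import Data.Nat as ℕ using (ℕ; zero; suc; _∸_; _≤_; _<ᵇ_)
open import Data.Nat.Coprimality using (Coprime; coprime-Bézout; prime⇒coprime)
open import Data.Nat.Divisibility as ℕ using ()
open import Data.Nat.GCD using (module Bézout)
open import Data.Nat.Primality
  using (Prime; euclidsLemma; prime⇒irreducible; prime⇒nonZero; prime⇒nonTrivial)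
open import Data.Nat.Properties as ℕ using ()
open import Data.Product using (Σ; ∃; _×_; _,_; proj₁; proj₂)
open import Data.Sum using (_⊎_; inj₁; inj₂)
open import Function using (_∘_)
open import Level using (0ℓ)
open import Relation.Binary using (IsEquivalence; Setoid)
open import Relation.Binary.PropositionalEquality
import Relation.Binary.Reasoning.Setoid
open import Relation.Nullary using (¬_; ¬?; yes; no; Dec)

module Determinants where

  open ≡-Reasoning

  sumFin-cong : ∀ n {f g : Fin n → ℤ} → (∀ j → f j ≡ g j) → sumFin n f ≡ sumFin n g
  sumFin-cong zero    f≗g = refl
  sumFin-cong (suc n) f≗g = cong₂ _+_ (f≗g fz) (sumFin-cong n (λ j → f≗g (fs j)))

  sumFin-zero : ∀ n (f : Fin n → ℤ) → (∀ j → f j ≡ + 0) → sumFin n f ≡ + 0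
  sumFin-zero zero    f f≗0 = refl
  sumFin-zero (suc n) f f≗0 = cong₂ _+_ (f≗0 fz) (sumFin-zero n (λ j → f (fs j)) (λ j → f≗0 (fs j)))

  sumFin-+ : ∀ n (f g : Fin n → ℤ) → sumFin n (λ j → f j + g j) ≡ sumFin n f + sumFin n g
  sumFin-+ zero    f g = refl
  sumFin-+ (suc n) f g = trans (cong (_+_ (f fz + g fz)) (sumFin-+ n (λ j → f (fs j)) (λ j → g (fs j))))
                               (interchange (f fz) (g fz) _ _)
    where interchange : ∀ a b c d → (a + b) + (c + d) ≡ (a + c) + (b + d)
          interchange = solve-∀

  sumFin-*ˡ : ∀ n (c : ℤ) (f : Fin n → ℤ) → sumFin n (λ j → c * f j) ≡ c * sumFin n f
  sumFin-*ˡ zero    c f = sym (ℤ.*-zeroʳ c)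
  sumFin-*ˡ (suc n) c f = trans (cong (_+_ (c * f fz)) (sumFin-*ˡ n c (λ j → f (fs j))))
                                (sym (ℤ.*-distribˡ-+ c (f fz) _))

  sumFin-neg : ∀ n (f : Fin n → ℤ) → sumFin n (λ j → - f j) ≡ - sumFin n f
  sumFin-neg zero    f = refl
  sumFin-neg (suc n) f = trans (cong (_+_ (- f fz)) (sumFin-neg n (λ j → f (fs j))))
                               (sym (ℤ.neg-distrib-+ (f fz) _))

  sumFin-linear : ∀ n (c d : ℤ) (f g : Fin n → ℤ) →
    sumFin n (λ j → c * f j + d * g j) ≡ c * sumFin n f + d * sumFin n g
  sumFin-linear n c d f g =
    trans (sumFin-+ n (λ j → c * f j) (λ j → d * g j)) (cong₂ _+_ (sumFin-*ˡ n c f) (sumFin-*ˡ n d g))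

  sumFin-comm : ∀ n m (f : Fin n → Fin m → ℤ) →
    sumFin n (λ i → sumFin m (f i)) ≡ sumFin m (λ j → sumFin n (λ i → f i j))
  sumFin-comm zero    m f = sym (sumFin-zero m (λ _ → + 0) (λ _ → refl))
  sumFin-comm (suc n) m f =
    trans (cong (_+_ (sumFin m (f fz))) (sumFin-comm n m (λ i → f (fs i))))
          (sym (sumFin-+ m (f fz) (λ j → sumFin n (λ i → f (fs i) j))))

  sumFin-punchIn : ∀ n (j : Fin (suc n)) (f : Fin (suc n) → ℤ) →
    sumFin (suc n) f ≡ f j + sumFin n (λ k → f (punchIn j k))
  sumFin-punchIn n       fz     f = refl
  sumFin-punchIn (suc n) (fs j) f = trans (cong (_+_ (f fz)) (sumFin-punchIn n j (λ k → f (fs k))))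
                                          (swap-front (f fz) (f (fs j)) _)
    where swap-front : ∀ a b c → a + (b + c) ≡ b + (a + c)
          swap-front = solve-∀

  Matrix : ℕ → Set
  Matrix n = Fin n → Fin n → ℤ

  minor : ∀ {n} → Matrix (suc n) → Fin (suc n) → Matrix n
  minor A j i k = A (fs i) (punchIn j k)

  laplaceTerm : ∀ n → Matrix (suc n) → Fin (suc n) → ℤ
  laplaceTerm n A j = sign (toℕ j) * A fz j * det n (minor A j)

  det-cong : ∀ n {A B : Matrix n} → (∀ i j → A i j ≡ B i j) → det n A ≡ det n B
  det-cong zero    A≗B = refl
  det-cong (suc n) A≗B = sumFin-cong (suc n) λ j →
    cong₂ (λ a b → sign (toℕ j) * a * b) (A≗B fz j) (det-cong n (λ i k → A≗B (fs i) (punchIn j k)))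

  punchIn-punchOut-comm : ∀ {n} (a b : Fin (suc (suc n))) (a≢b : a ≢ b) (b≢a : b ≢ a) (l : Fin n) →
    punchIn a (punchIn (punchOut a≢b) l) ≡ punchIn b (punchIn (punchOut b≢a) l)
  punchIn-punchOut-comm fz       fz       a≢b b≢a l      = ⊥-elim (a≢b refl)
  punchIn-punchOut-comm fz       (fs b)   a≢b b≢a l      = refl
  punchIn-punchOut-comm (fs a)   fz       a≢b b≢a l      = refl
  punchIn-punchOut-comm {zero}  (fs fz) (fs fz) a≢b b≢a ()
  punchIn-punchOut-comm {suc n} (fs a)  (fs b)  a≢b b≢a fz     = refl
  punchIn-punchOut-comm {suc n} (fs a)  (fs b)  a≢b b≢a (fs l) =
    cong fs (punchIn-punchOut-comm a b (a≢b ∘ cong fs) (b≢a ∘ cong fs) l)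

  sign-punchOut-antisym : ∀ {n} (a b : Fin (suc (suc n))) (a≢b : a ≢ b) (b≢a : b ≢ a) →
    sign (toℕ a) * sign (toℕ (punchOut a≢b)) ≡ - (sign (toℕ b) * sign (toℕ (punchOut b≢a)))
  sign-punchOut-antisym fz     fz     a≢b b≢a = ⊥-elim (a≢b refl)
  sign-punchOut-antisym fz     (fs b) a≢b b≢a = lemma (sign (toℕ b))
    where lemma : ∀ s → + 1 * s ≡ - (- s * + 1)
          lemma = solve-∀
  sign-punchOut-antisym (fs a) fz     a≢b b≢a = lemma (sign (toℕ a))
    where lemma : ∀ s → - s * + 1 ≡ - (+ 1 * s)
          lemma = solve-∀
  sign-punchOut-antisym {zero}  (fs fz) (fs fz) a≢b b≢a = ⊥-elim (a≢b refl)
  sign-punchOut-antisym {suc n} (fs a)  (fs b)  a≢b b≢a =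
    lemma (sign (toℕ a)) (sign (toℕ (punchOut a≢b′))) (sign (toℕ b)) (sign (toℕ (punchOut b≢a′)))
          (sign-punchOut-antisym a b a≢b′ b≢a′)
    where a≢b′ = a≢b ∘ cong fs
          b≢a′ = b≢a ∘ cong fs
          lemma : ∀ x y u v → x * y ≡ - (u * v) → (- x) * (- y) ≡ - ((- u) * (- v))
          lemma x y u v e = trans (neg*neg x y) (trans e (cong -_ (sym (neg*neg u v))))
            where neg*neg : ∀ x y → (- x) * (- y) ≡ x * y
                  neg*neg = solve-∀

  -- Expanding along the first two rows gives Σ_a Σ_b A₀ₐ A₁ᵦ H a b with H antisymmetric,
  -- so swapping these rows negates the determinant.
  module TwoRowExpansion {n : ℕ} (R : Fin n → Fin (suc (suc n)) → ℤ) where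

    minor₂ : Fin (suc (suc n)) → Fin (suc n) → ℤ
    minor₂ a k = det n (λ i l → R i (punchIn a (punchIn k l)))

    cofactor₂ : Fin (suc (suc n)) → Fin (suc (suc n)) → ℤ
    cofactor₂ a b with a ≟ b
    ... | yes _   = + 0
    ... | no  a≢b = sign (toℕ a) * sign (toℕ (punchOut a≢b)) * minor₂ a (punchOut a≢b)

    cofactor₂-diag : ∀ a → cofactor₂ a a ≡ + 0
    cofactor₂-diag a with a ≟ a
    ... | yes _   = refl
    ... | no  a≢a = ⊥-elim (a≢a refl)

    cofactor₂-punchIn : ∀ a k → cofactor₂ a (punchIn a k) ≡ sign (toℕ a) * sign (toℕ k) * minor₂ a k
    cofactor₂-punchIn a k with a ≟ punchIn a k
    ... | yes a≡ = ⊥-elim (punchInᵢ≢i a k (sym a≡))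
    ... | no  a≢ = cong (λ z → sign (toℕ a) * sign (toℕ z) * minor₂ a z)
                        (trans (punchOut-cong a refl) (punchOut-punchIn a))

    cofactor₂-antisym : ∀ a b → cofactor₂ a b ≡ - cofactor₂ b a
    cofactor₂-antisym a b with a ≟ b | b ≟ a
    ... | yes _   | yes _   = refl
    ... | yes a≡b | no  b≢a = ⊥-elim (b≢a (sym a≡b))
    ... | no  a≢b | yes b≡a = ⊥-elim (a≢b (sym b≡a))
    ... | no  a≢b | no  b≢a = begin
      sign (toℕ a) * sign (toℕ (punchOut a≢b)) * minor₂ a (punchOut a≢b)
        ≡⟨ cong₂ _*_ (sign-punchOut-antisym a b a≢b b≢a)
                     (det-cong n (λ i l → cong (R i) (punchIn-punchOut-comm a b a≢b b≢a l))) ⟩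
      - (sign (toℕ b) * sign (toℕ (punchOut b≢a))) * minor₂ b (punchOut b≢a)
        ≡⟨ sym (ℤ.neg-distribˡ-* (sign (toℕ b) * sign (toℕ (punchOut b≢a))) (minor₂ b (punchOut b≢a))) ⟩
      - (sign (toℕ b) * sign (toℕ (punchOut b≢a)) * minor₂ b (punchOut b≢a)) ∎

  open TwoRowExpansion using (cofactor₂; cofactor₂-diag; cofactor₂-punchIn; cofactor₂-antisym)

  det-expand₂ : ∀ n (A : Matrix (suc (suc n))) →
    det (suc (suc n)) A ≡
    sumFin (suc (suc n)) (λ a → sumFin (suc (suc n)) (λ b → A fz a * A (fs fz) b * cofactor₂ (λ i → A (fs (fs i))) a b))
  det-expand₂ n A = sumFin-cong (suc (suc n)) λ a → begin
    sign (toℕ a) * A fz a * sumFin (suc n) (λ k → sign (toℕ k) * A (fs fz) (punchIn a k) * minor₂ a k)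
      ≡⟨ sym (sumFin-*ˡ (suc n) (sign (toℕ a) * A fz a) (λ k → sign (toℕ k) * A (fs fz) (punchIn a k) * minor₂ a k)) ⟩
    sumFin (suc n) (λ k → sign (toℕ a) * A fz a * (sign (toℕ k) * A (fs fz) (punchIn a k) * minor₂ a k))
      ≡⟨ sumFin-cong (suc n) (λ k → trans (regroup (sign (toℕ a)) (A fz a) (sign (toℕ k)) (A (fs fz) (punchIn a k)) (minor₂ a k))
                                          (cong (A fz a * A (fs fz) (punchIn a k) *_) (sym (cofactor₂-punchIn R a k)))) ⟩
    sumFin (suc n) (λ k → term a (punchIn a k))
      ≡⟨ sym (ℤ.+-identityˡ _) ⟩
    + 0 + sumFin (suc n) (λ k → term a (punchIn a k))
      ≡⟨ cong (_+ sumFin (suc n) (λ k → term a (punchIn a k)))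
              (sym (trans (cong (A fz a * A (fs fz) a *_) (cofactor₂-diag R a)) (ℤ.*-zeroʳ (A fz a * A (fs fz) a)))) ⟩
    term a a + sumFin (suc n) (λ k → term a (punchIn a k))
      ≡⟨ sym (sumFin-punchIn (suc n) a (term a)) ⟩
    sumFin (suc (suc n)) (term a) ∎
    where
      R = λ i → A (fs (fs i))
      minor₂ = TwoRowExpansion.minor₂ R
      term : Fin (suc (suc n)) → Fin (suc (suc n)) → ℤ
      term a b = A fz a * A (fs fz) b * cofactor₂ R a b
      regroup : ∀ s a t b d → s * a * (t * b * d) ≡ a * b * (s * t * d)
      regroup = solve-∀

  swapRows₀₁ : ∀ {n} → Matrix (suc (suc n)) → Matrix (suc (suc n))
  swapRows₀₁ A fz          = A (fs fz)
  swapRows₀₁ A (fs fz)     = A fz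
  swapRows₀₁ A (fs (fs i)) = A (fs (fs i))

  det-swapRows₀₁ : ∀ n (A : Matrix (suc (suc n))) →
    det (suc (suc n)) (swapRows₀₁ A) ≡ - det (suc (suc n)) A
  det-swapRows₀₁ n A = begin
    det N (swapRows₀₁ A)
      ≡⟨ det-expand₂ n (swapRows₀₁ A) ⟩
    ∑ (λ a → ∑ (λ b → A (fs fz) a * A fz b * H a b))
      ≡⟨ sumFin-comm N N (λ a b → A (fs fz) a * A fz b * H a b) ⟩
    ∑ (λ b → ∑ (λ a → A (fs fz) a * A fz b * H a b))
      ≡⟨ sumFin-cong N (λ b → sumFin-cong N (λ a → antisym a b)) ⟩
    ∑ (λ b → ∑ (λ a → - (A fz b * A (fs fz) a * H b a)))
      ≡⟨ sumFin-cong N (λ b → sumFin-neg N (λ a → A fz b * A (fs fz) a * H b a)) ⟩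
    ∑ (λ b → - ∑ (λ a → A fz b * A (fs fz) a * H b a))
      ≡⟨ sumFin-neg N (λ b → ∑ (λ a → A fz b * A (fs fz) a * H b a)) ⟩
    - ∑ (λ b → ∑ (λ a → A fz b * A (fs fz) a * H b a))
      ≡⟨ cong -_ (sym (det-expand₂ n A)) ⟩
    - det N A ∎
    where
      N = suc (suc n)
      ∑ = sumFin N
      H = cofactor₂ (λ i → A (fs (fs i)))
      antisym : ∀ a b → A (fs fz) a * A fz b * H a b ≡ - (A fz b * A (fs fz) a * H b a)
      antisym a b = trans (cong (A (fs fz) a * A fz b *_) (cofactor₂-antisym _ a b))
                          (lemma (A (fs fz) a) (A fz b) (H b a))
        where lemma : ∀ x y h → x * y * (- h) ≡ - (y * x * h)
              lemma = solve-∀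

  x≡-x⇒x≡0 : ∀ x → x ≡ - x → x ≡ + 0
  x≡-x⇒x≡0 x x≡-x = ℤ.*-cancelˡ-≡ (+ 2) x (+ 0) (begin
    + 2 * x   ≡⟨ double x ⟩
    x + x     ≡⟨ cong (_+_ x) x≡-x ⟩
    x + - x   ≡⟨ ℤ.+-inverseʳ x ⟩
    + 0       ∎)
    where double : ∀ x → + 2 * x ≡ x + x
          double = solve-∀

  mutual
    det-repeatedRow : ∀ n (A : Matrix n) (a b : Fin n) → a ≢ b → (∀ l → A a l ≡ A b l) → det n A ≡ + 0
    det-repeatedRow (suc m) A fz     fz     a≢b eq = ⊥-elim (a≢b refl)
    det-repeatedRow (suc m) A fz     (fs b) a≢b eq = det-repeatedRow₀ m A b eq
    det-repeatedRow (suc m) A (fs a) fz     a≢b eq = det-repeatedRow₀ m A a (λ l → sym (eq l))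
    det-repeatedRow (suc m) A (fs a) (fs b) a≢b eq = det-repeatedRowₛ m A a b (a≢b ∘ cong fs) eq

    -- Swapping rows 0 and 1 moves the repeat below the first row, unless it is the repeat of rows 0 and 1,
    -- which antisymmetry kills.
    det-repeatedRow₀ : ∀ m (A : Matrix (suc m)) (b : Fin m) → (∀ l → A fz l ≡ A (fs b) l) →
                       det (suc m) A ≡ + 0
    det-repeatedRow₀ (suc m) A fz eq =
      x≡-x⇒x≡0 (det (suc (suc m)) A) (trans (sym (det-cong (suc (suc m)) swap≗id)) (det-swapRows₀₁ m A))
      where swap≗id : ∀ i l → swapRows₀₁ A i l ≡ A i l
            swap≗id fz          l = sym (eq l)
            swap≗id (fs fz)     l = eq l
            swap≗id (fs (fs i)) l = refl
    det-repeatedRow₀ (suc m) A (fs b) eq = begin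
      det (suc (suc m)) A                    ≡⟨ sym (ℤ.neg-involutive _) ⟩
      - - det (suc (suc m)) A                ≡⟨ cong -_ (sym (det-swapRows₀₁ m A)) ⟩
      - det (suc (suc m)) (swapRows₀₁ A)     ≡⟨ cong -_ (det-repeatedRowₛ (suc m) (swapRows₀₁ A) fz (fs b) (λ ()) eq) ⟩
      + 0                                    ∎

    det-repeatedRowₛ : ∀ m (A : Matrix (suc m)) (a b : Fin m) → a ≢ b → (∀ l → A (fs a) l ≡ A (fs b) l) →
                       det (suc m) A ≡ + 0
    det-repeatedRowₛ m A a b a≢b eq = sumFin-zero (suc m) (laplaceTerm m A) λ j →
      trans (cong (sign (toℕ j) * A fz j *_) (det-repeatedRow m (minor A j) a b a≢b (λ l → eq (punchIn j l))))
            (ℤ.*-zeroʳ (sign (toℕ j) * A fz j))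

  det-linear : ∀ n (A B C : Matrix n) (i : Fin n) (c d : ℤ) →
    (∀ k → k ≢ i → ∀ l → (B k l ≡ A k l) × (C k l ≡ A k l)) →
    (∀ l → A i l ≡ c * B i l + d * C i l) →
    det n A ≡ c * det n B + d * det n C
  det-linear (suc n) A B C fz c d others row =
    trans (sumFin-cong (suc n) λ j → begin
            sign (toℕ j) * A fz j * det n (minor A j)
              ≡⟨ cong₂ (λ x y → sign (toℕ j) * x * y) (row j) (det-cong n (λ i l → sym (B≡A i (punchIn j l)))) ⟩
            sign (toℕ j) * (c * B fz j + d * C fz j) * det n (minor B j)
              ≡⟨ distrib (sign (toℕ j)) (B fz j) (C fz j) c d (det n (minor B j)) ⟩
            c * laplaceTerm n B j + d * (sign (toℕ j) * C fz j * det n (minor B j))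
              ≡⟨ cong (λ z → c * laplaceTerm n B j + d * (sign (toℕ j) * C fz j * z))
                      (det-cong n (λ i l → trans (B≡A i (punchIn j l)) (sym (C≡A i (punchIn j l))))) ⟩
            c * laplaceTerm n B j + d * laplaceTerm n C j ∎)
          (sumFin-linear (suc n) c d (laplaceTerm n B) (laplaceTerm n C))
    where
      B≡A : ∀ i l → B (fs i) l ≡ A (fs i) l
      B≡A i l = proj₁ (others (fs i) (λ ()) l)
      C≡A : ∀ i l → C (fs i) l ≡ A (fs i) l
      C≡A i l = proj₂ (others (fs i) (λ ()) l)
      distrib : ∀ s b c' c d m → s * (c * b + d * c') * m ≡ c * (s * b * m) + d * (s * c' * m)
      distrib = solve-∀
  det-linear (suc n) A B C (fs i) c d others row =
    trans (sumFin-cong (suc n) λ j → begin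
            sign (toℕ j) * A fz j * det n (minor A j)
              ≡⟨ cong (sign (toℕ j) * A fz j *_)
                      (det-linear n (minor A j) (minor B j) (minor C j) i c d
                                  (λ k k≢i l → others (fs k) (k≢i ∘ suc-injective) (punchIn j l))
                                  (λ l → row (punchIn j l))) ⟩
            sign (toℕ j) * A fz j * (c * det n (minor B j) + d * det n (minor C j))
              ≡⟨ distrib (sign (toℕ j)) (A fz j) c d (det n (minor B j)) (det n (minor C j)) ⟩
            c * (sign (toℕ j) * A fz j * det n (minor B j)) + d * (sign (toℕ j) * A fz j * det n (minor C j))
              ≡⟨ cong₂ (λ x y → c * (sign (toℕ j) * x * det n (minor B j)) + d * (sign (toℕ j) * y * det n (minor C j)))
                       (sym (proj₁ (others fz (λ ()) j))) (sym (proj₂ (others fz (λ ()) j))) ⟩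
            c * laplaceTerm n B j + d * laplaceTerm n C j ∎)
          (sumFin-linear (suc n) c d (laplaceTerm n B) (laplaceTerm n C))
    where
      distrib : ∀ s a c d mb mc → s * a * (c * mb + d * mc) ≡ c * (s * a * mb) + d * (s * a * mc)
      distrib = solve-∀

  replaceRow : ∀ {n} → Fin n → (Fin n → ℤ) → Matrix n → Matrix n
  replaceRow i u A k with k ≟ i
  ... | yes _ = u
  ... | no  _ = A k

  replaceRow-here : ∀ {n} (i : Fin n) u (A : Matrix n) → replaceRow i u A i ≡ u
  replaceRow-here i u A with i ≟ i
  ... | yes _   = refl
  ... | no  i≢i = ⊥-elim (i≢i refl)

  replaceRow-there : ∀ {n} {i k : Fin n} u (A : Matrix n) → k ≢ i → replaceRow i u A k ≡ A k
  replaceRow-there {i = i} {k} u A k≢i with k ≟ i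
  ... | yes k≡i = ⊥-elim (k≢i k≡i)
  ... | no  _   = refl

  det-addRow₀ : ∀ n (A B : Matrix (suc n)) (i : Fin n) (c t : ℤ) →
    (∀ k → k ≢ fs i → ∀ l → B k l ≡ A k l) →
    (∀ l → B (fs i) l ≡ c * A (fs i) l + t * A fz l) →
    det (suc n) B ≡ c * det (suc n) A
  det-addRow₀ n A B i c t others row = begin
    det (suc n) B                         ≡⟨ det-linear (suc n) B A C (fs i) c t others′ row′ ⟩
    c * det (suc n) A + t * det (suc n) C ≡⟨ cong (λ z → c * det (suc n) A + t * z) detC≡0 ⟩
    c * det (suc n) A + t * + 0           ≡⟨ cong (_+_ (c * det (suc n) A)) (ℤ.*-zeroʳ t) ⟩
    c * det (suc n) A + + 0               ≡⟨ ℤ.+-identityʳ _ ⟩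
    c * det (suc n) A                     ∎
    where
      C = replaceRow (fs i) (A fz) A
      C≡A : ∀ k → k ≢ fs i → ∀ l → C k l ≡ A k l
      C≡A k k≢i l = cong (λ r → r l) (replaceRow-there (A fz) A k≢i)
      others′ : ∀ k → k ≢ fs i → ∀ l → (A k l ≡ B k l) × (C k l ≡ B k l)
      others′ k k≢i l = sym (others k k≢i l) , trans (C≡A k k≢i l) (sym (others k k≢i l))
      row′ : ∀ l → B (fs i) l ≡ c * A (fs i) l + t * C (fs i) l
      row′ l = trans (row l) (cong (λ z → c * A (fs i) l + t * z) (sym (cong (λ r → r l) (replaceRow-here (fs i) (A fz) A))))
      detC≡0 : det (suc n) C ≡ + 0
      detC≡0 = det-repeatedRow₀ n C i (λ l → trans (C≡A fz (λ ()) l) (sym (cong (λ r → r l) (replaceRow-here (fs i) (A fz) A))))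

  <ᵇ-suc-≢ : ∀ j k → j ≢ k → (j <ᵇ suc k) ≡ (j <ᵇ k)
  <ᵇ-suc-≢ zero    zero    j≢k = ⊥-elim (j≢k refl)
  <ᵇ-suc-≢ zero    (suc k) j≢k = refl
  <ᵇ-suc-≢ (suc j) zero    j≢k = refl
  <ᵇ-suc-≢ (suc j) (suc k) j≢k = <ᵇ-suc-≢ j k (j≢k ∘ cong suc)

  n<ᵇn≡false : ∀ n → (n <ᵇ n) ≡ false
  n<ᵇn≡false zero    = refl
  n<ᵇn≡false (suc n) = n<ᵇn≡false n

  n<ᵇ1+n≡true : ∀ n → (n <ᵇ suc n) ≡ true
  n<ᵇ1+n≡true zero    = refl
  n<ᵇ1+n≡true (suc n) = n<ᵇ1+n≡true n

  <⇒<ᵇ≡true : ∀ {j k} → j ℕ.< k → (j <ᵇ k) ≡ true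
  <⇒<ᵇ≡true {zero}  {suc k} _           = refl
  <⇒<ᵇ≡true {suc j} {suc k} (ℕ.s≤s j<k) = <⇒<ᵇ≡true j<k

  module Eliminate {m : ℕ} (A : Matrix (suc m)) (c : ℤ) (t : Fin m → ℤ) where

    eliminated : Fin m → Fin (suc m) → ℤ
    eliminated i l = c * A (fs i) l + t i * A fz l

    firstRowsEliminated : ℕ → Matrix (suc m)
    firstRowsEliminated k fz     = A fz
    firstRowsEliminated k (fs i) = if toℕ i <ᵇ k then eliminated i else A (fs i)

    det-step : ∀ k → k ℕ.< m →
      det (suc m) (firstRowsEliminated (suc k)) ≡ c * det (suc m) (firstRowsEliminated k)
    det-step k k<m = det-addRow₀ m (firstRowsEliminated k) (firstRowsEliminated (suc k)) i c (t i) others row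
      where
        i = fromℕ< k<m
        i≡k : toℕ i ≡ k
        i≡k = toℕ-fromℕ< k<m
        others : ∀ r → r ≢ fs i → ∀ l → firstRowsEliminated (suc k) r l ≡ firstRowsEliminated k r l
        others fz     _   l = refl
        others (fs j) j≢i l rewrite <ᵇ-suc-≢ (toℕ j) k (λ j≡k → j≢i (cong fs (toℕ-injective (trans j≡k (sym i≡k))))) = refl
        row : ∀ l → firstRowsEliminated (suc k) (fs i) l
                    ≡ c * firstRowsEliminated k (fs i) l + t i * firstRowsEliminated k fz l
        row l rewrite i≡k | n<ᵇ1+n≡true k | n<ᵇn≡false k = refl

    det-firstRowsEliminated : ∀ k → k ℕ.≤ m → det (suc m) (firstRowsEliminated k) ≡ c ^ k * det (suc m) A
    det-firstRowsEliminated zero    _   = trans (det-cong (suc m) none) (sym (ℤ.*-identityˡ _))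
      where none : ∀ i l → firstRowsEliminated zero i l ≡ A i l
            none fz     l = refl
            none (fs i) l = refl
    det-firstRowsEliminated (suc k) k<m = begin
      det (suc m) (firstRowsEliminated (suc k))  ≡⟨ det-step k k<m ⟩
      c * det (suc m) (firstRowsEliminated k)    ≡⟨ cong (c *_) (det-firstRowsEliminated k (ℕ.<⇒≤ k<m)) ⟩
      c * (c ^ k * det (suc m) A)                ≡⟨ sym (ℤ.*-assoc c (c ^ k) _) ⟩
      c ^ suc k * det (suc m) A                  ∎

  det-eliminate : ∀ m (A B : Matrix (suc m)) (c : ℤ) (t : Fin m → ℤ) →
    (∀ l → B fz l ≡ A fz l) → (∀ i l → B (fs i) l ≡ c * A (fs i) l + t i * A fz l) →
    det (suc m) B ≡ c ^ m * det (suc m) A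
  det-eliminate m A B c t row₀ rows =
    trans (det-cong (suc m) B≡all) (Eliminate.det-firstRowsEliminated A c t m ℕ.≤-refl)
    where
      B≡all : ∀ i l → B i l ≡ Eliminate.firstRowsEliminated A c t m i l
      B≡all fz     l = row₀ l
      B≡all (fs i) l rewrite <⇒<ᵇ≡true (toℕ<n i) = rows i l

  det-zeroColumn₀ : ∀ n (A : Matrix (suc n)) → (∀ i → A i fz ≡ + 0) → det (suc n) A ≡ + 0
  det-zeroColumn₀ zero    A col = cong (λ z → + 1 * z * + 1 + + 0) (col fz)
  det-zeroColumn₀ (suc n) A col = sumFin-zero (suc (suc n)) (laplaceTerm (suc n) A) term≡0
    where
      term≡0 : ∀ j → laplaceTerm (suc n) A j ≡ + 0
      term≡0 fz     = trans (cong (λ z → + 1 * z * det (suc n) (minor A fz)) (col fz))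
                            (ℤ.*-zeroˡ (det (suc n) (minor A fz)))
      term≡0 (fs j) = trans (cong (sign (toℕ (fs j)) * A fz (fs j) *_)
                                  (det-zeroColumn₀ n (minor A (fs j)) (λ i → col (fs i))))
                            (ℤ.*-zeroʳ (sign (toℕ (fs j)) * A fz (fs j)))

  det-firstColumn : ∀ n (A : Matrix (suc n)) → (∀ i → A (fs i) fz ≡ + 0) →
    det (suc n) A ≡ A fz fz * det n (minor A fz)
  det-firstColumn zero    A col = lemma (A fz fz)
    where lemma : ∀ a → + 1 * a * + 1 + + 0 ≡ a * + 1
          lemma = solve-∀
  det-firstColumn (suc n) A col = begin
    laplaceTerm (suc n) A fz + sumFin (suc n) (λ j → laplaceTerm (suc n) A (fs j))
      ≡⟨ cong (_+_ (laplaceTerm (suc n) A fz)) (sumFin-zero (suc n) _ term≡0) ⟩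
    + 1 * A fz fz * det (suc n) (minor A fz) + + 0
      ≡⟨ lemma (A fz fz) (det (suc n) (minor A fz)) ⟩
    A fz fz * det (suc n) (minor A fz) ∎
    where
      term≡0 : ∀ j → laplaceTerm (suc n) A (fs j) ≡ + 0
      term≡0 j = trans (cong (sign (toℕ (fs j)) * A fz (fs j) *_)
                             (det-zeroColumn₀ n (minor A (fs j)) col))
                       (ℤ.*-zeroʳ (sign (toℕ (fs j)) * A fz (fs j)))
      lemma : ∀ a d → + 1 * a * d + + 0 ≡ a * d
      lemma = solve-∀

  rotateRows : ∀ {m} → Matrix (suc m) → Matrix (suc m)
  rotateRows {m} A fz     = A (fromℕ m)
  rotateRows {m} A (fs i) = A (inject₁ i)

  det-rotateRows : ∀ m (A : Matrix (suc m)) → det (suc m) (rotateRows A) ≡ sign m * det (suc m) A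
  det-rotateRows zero    A = sym (ℤ.*-identityˡ _)
  det-rotateRows (suc m) A = begin
    det N B                                                     ≡⟨ sym (ℤ.neg-involutive (det N B)) ⟩
    - - det N B                                                 ≡⟨ cong -_ (sym (det-swapRows₀₁ m B)) ⟩
    - det N (swapRows₀₁ B)                                      ≡⟨ cong -_ (sumFin-cong N term) ⟩
    - sumFin N (λ j → sign m * laplaceTerm (suc m) A j)         ≡⟨ cong -_ (sumFin-*ˡ N (sign m) (laplaceTerm (suc m) A)) ⟩
    - (sign m * det N A)                                        ≡⟨ ℤ.neg-distribˡ-* (sign m) (det N A) ⟩
    sign (suc m) * det N A                                      ∎
    where
      N = suc (suc m)
      B = rotateRows A
      minor≡ : ∀ j i l → minor (swapRows₀₁ B) j i l ≡ rotateRows (minor A j) i l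
      minor≡ j fz     l = refl
      minor≡ j (fs i) l = refl
      term : ∀ j → laplaceTerm (suc m) (swapRows₀₁ B) j ≡ sign m * laplaceTerm (suc m) A j
      term j = trans (cong (sign (toℕ j) * A fz j *_)
                           (trans (det-cong (suc m) (minor≡ j)) (det-rotateRows m (minor A j))))
                     (lemma (sign (toℕ j)) (A fz j) (sign m) (det (suc m) (minor A j)))
        where lemma : ∀ s a t d → s * a * (t * d) ≡ t * (s * a * d)
              lemma = solve-∀

  identity : ∀ {n} → Matrix n
  identity fz     fz     = + 1
  identity fz     (fs _) = + 0
  identity (fs _) fz     = + 0
  identity (fs i) (fs j) = identity i j

  det-identity : ∀ n → det n identity ≡ + 1
  det-identity zero    = refl
  det-identity (suc n) = trans (det-firstColumn n identity (λ _ → refl))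
                               (trans (ℤ.*-identityˡ _) (det-identity n))

  det-scale : ∀ n (c : ℤ) (A : Matrix n) → det n (λ i j → c * A i j) ≡ c ^ n * det n A
  det-scale zero    c A = refl
  det-scale (suc n) c A =
    trans (sumFin-cong (suc n) λ j →
             trans (cong (sign (toℕ j) * (c * A fz j) *_) (det-scale n c (minor A j)))
                   (lemma (sign (toℕ j)) c (A fz j) (c ^ n) (det n (minor A j))))
          (sumFin-*ˡ (suc n) (c * c ^ n) (laplaceTerm n A))
    where lemma : ∀ s c a cn d → s * (c * a) * (cn * d) ≡ (c * cn) * (s * a * d)
          lemma = solve-∀

  det-row₀-combination : ∀ n (A : Matrix (suc n)) K (c : Fin K → ℤ) (U : Fin K → Fin (suc n) → ℤ) →
    (∀ l → A fz l ≡ sumFin K (λ k → c k * U k l)) →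
    det (suc n) A ≡ sumFin K (λ k → c k * det (suc n) (replaceRow fz (U k) A))
  det-row₀-combination n A K c U row₀ = begin
    sumFin (suc n) (λ l → sign (toℕ l) * A fz l * m l)
      ≡⟨ sumFin-cong (suc n) (λ l → cong (λ z → sign (toℕ l) * z * m l) (row₀ l)) ⟩
    sumFin (suc n) (λ l → sign (toℕ l) * sumFin K (λ k → c k * U k l) * m l)
      ≡⟨ sumFin-cong (suc n) expand ⟩
    sumFin (suc n) (λ l → sumFin K (λ k → c k * (sign (toℕ l) * U k l * m l)))
      ≡⟨ sumFin-comm (suc n) K (λ l k → c k * (sign (toℕ l) * U k l * m l)) ⟩
    sumFin K (λ k → sumFin (suc n) (λ l → c k * (sign (toℕ l) * U k l * m l)))
      ≡⟨ sumFin-cong K (λ k → sumFin-*ˡ (suc n) (c k) (λ l → sign (toℕ l) * U k l * m l)) ⟩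
    sumFin K (λ k → c k * det (suc n) (replaceRow fz (U k) A)) ∎
    where
      m : Fin (suc n) → ℤ
      m l = det n (minor A l)
      expand : ∀ l → sign (toℕ l) * sumFin K (λ k → c k * U k l) * m l
                     ≡ sumFin K (λ k → c k * (sign (toℕ l) * U k l * m l))
      expand l = begin
        sign (toℕ l) * sumFin K (λ k → c k * U k l) * m l
          ≡⟨ lemma₁ (sign (toℕ l)) (sumFin K (λ k → c k * U k l)) (m l) ⟩
        sign (toℕ l) * m l * sumFin K (λ k → c k * U k l)
          ≡⟨ sym (sumFin-*ˡ K (sign (toℕ l) * m l) (λ k → c k * U k l)) ⟩
        sumFin K (λ k → sign (toℕ l) * m l * (c k * U k l))
          ≡⟨ sumFin-cong K (λ k → lemma₂ (sign (toℕ l)) (m l) (c k) (U k l)) ⟩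
        sumFin K (λ k → c k * (sign (toℕ l) * U k l * m l)) ∎
        where lemma₁ : ∀ s x y → s * x * y ≡ s * y * x
              lemma₁ = solve-∀
              lemma₂ : ∀ s y c u → s * y * (c * u) ≡ c * (s * u * y)
              lemma₂ = solve-∀

open Determinants

infix 4 _≐_
record _≐_ (f g : Poly) : Set where
  constructor mk≐
  field at≐ : ∀ k → coeff f k ≡ coeff g k
open _≐_ public

≐-refl : ∀ {f} → f ≐ f
≐-refl = mk≐ λ k → refl

≐-sym : ∀ {f g} → f ≐ g → g ≐ f
≐-sym e = mk≐ λ k → sym (at≐ e k)

≐-trans : ∀ {f g h} → f ≐ g → g ≐ h → f ≐ h
≐-trans e1 e2 = mk≐ λ k → trans (at≐ e1 k) (at≐ e2 k)

≐-cons : ∀ {a b f g} → a ≡ b → f ≐ g → (a ∷ f) ≐ (b ∷ g)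
≐-cons e1 e2 = mk≐ λ { zero → e1 ; (suc k) → at≐ e2 k }

coeff-+P : ∀ f g k → coeff (f +P g) k ≡ coeff f k + coeff g k
coeff-+P [] g k = sym (ℤ.+-identityˡ _)
coeff-+P (a ∷ f) [] k = sym (ℤ.+-identityʳ _)
coeff-+P (a ∷ f) (b ∷ g) zero = refl
coeff-+P (a ∷ f) (b ∷ g) (suc k) = coeff-+P f g k

coeff-scale : ∀ c f k → coeff (scale c f) k ≡ c * coeff f k
coeff-scale c [] k = sym (ℤ.*-zeroʳ c)
coeff-scale c (a ∷ f) zero = refl
coeff-scale c (a ∷ f) (suc k) = coeff-scale c f k

coeff-*P : ∀ a f g k → coeff ((a ∷ f) *P g) k ≡ a * coeff g k + coeff (+ 0 ∷ (f *P g)) k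
coeff-*P a f g k = trans (coeff-+P (scale a g) (+ 0 ∷ (f *P g)) k)
                         (cong (λ z → z + coeff (+ 0 ∷ (f *P g)) k) (coeff-scale a g k))

+P-cong : ∀ {f f' g g'} → f ≐ f' → g ≐ g' → (f +P g) ≐ (f' +P g')
+P-cong {f} {f'} {g} {g'} e1 e2 = mk≐ λ k →
  trans (coeff-+P f g k) (trans (cong₂ _+_ (at≐ e1 k) (at≐ e2 k)) (sym (coeff-+P f' g' k)))

scale-cong : ∀ c {f f'} → f ≐ f' → scale c f ≐ scale c f'
scale-cong c {f} {f'} e = mk≐ λ k → trans (coeff-scale c f k) (trans (cong (c *_) (at≐ e k)) (sym (coeff-scale c f' k)))

+P-comm : ∀ f g → (f +P g) ≐ (g +P f)
+P-comm f g = mk≐ λ k → trans (coeff-+P f g k) (trans (ℤ.+-comm (coeff f k) (coeff g k)) (sym (coeff-+P g f k)))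

+P-assoc : ∀ f g h → ((f +P g) +P h) ≐ (f +P (g +P h))
+P-assoc f g h = mk≐ λ k → trans (coeff-+P (f +P g) h k)
  (trans (cong (λ z → z + coeff h k) (coeff-+P f g k))
  (trans (ℤ.+-assoc (coeff f k) (coeff g k) (coeff h k))
  (trans (cong (λ z → coeff f k + z) (sym (coeff-+P g h k))) (sym (coeff-+P f (g +P h) k)))))

coeff-*P-zeroˡ : ∀ Z Q → Z ≐ [] → ∀ k → coeff (Z *P Q) k ≡ + 0
coeff-*P-zeroˡ [] Q e k = refl
coeff-*P-zeroˡ (a ∷ Z) Q e zero = trans (coeff-*P a Z Q zero) (trans (cong (λ z → z * coeff Q zero + + 0) (at≐ e zero)) (lemma (coeff Q zero)))
  where lemma : ∀ x → + 0 * x + + 0 ≡ + 0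
        lemma = solve-∀
coeff-*P-zeroˡ (a ∷ Z) Q e (suc k) = trans (coeff-*P a Z Q (suc k))
  (trans (cong₂ (λ x y → x * coeff Q (suc k) + y) (at≐ e zero) (coeff-*P-zeroˡ Z Q (mk≐ λ j → at≐ e (suc j)) k))
         (lemma (coeff Q (suc k))))
  where lemma : ∀ x → + 0 * x + + 0 ≡ + 0
        lemma = solve-∀

coeff-*P-congˡ : ∀ f f' Q → f ≐ f' → ∀ k → coeff (f *P Q) k ≡ coeff (f' *P Q) k
coeff-*P-congˡ [] [] Q e k = refl
coeff-*P-congˡ [] (b ∷ f') Q e k = sym (coeff-*P-zeroˡ (b ∷ f') Q (≐-sym e) k)
coeff-*P-congˡ (a ∷ f) [] Q e k = coeff-*P-zeroˡ (a ∷ f) Q e k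
coeff-*P-congˡ (a ∷ f) (b ∷ f') Q e k =
  trans (coeff-*P a f Q k) (trans (cong₂ _+_ (cong (_* coeff Q k) (at≐ e zero)) (shifted k)) (sym (coeff-*P b f' Q k)))
  where shifted : ∀ k → coeff (+ 0 ∷ (f *P Q)) k ≡ coeff (+ 0 ∷ (f' *P Q)) k
        shifted zero = refl
        shifted (suc k) = coeff-*P-congˡ f f' Q (mk≐ λ j → at≐ e (suc j)) k

*P-congˡ : ∀ {f f'} Q → f ≐ f' → (f *P Q) ≐ (f' *P Q)
*P-congˡ {f} {f'} Q e = mk≐ (coeff-*P-congˡ f f' Q e)

coeff-*P-distribʳ : ∀ f g h k → coeff ((f +P g) *P h) k ≡ coeff ((f *P h) +P (g *P h)) k
coeff-*P-distribʳ [] g h k = refl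
coeff-*P-distribʳ (a ∷ f) [] h k = sym (trans (coeff-+P ((a ∷ f) *P h) [] k) (ℤ.+-identityʳ _))
coeff-*P-distribʳ (a ∷ f) (b ∷ g) h zero =
  trans (coeff-*P (a + b) (f +P g) h zero)
  (trans (lemma (coeff h zero) a b)
  (sym (trans (coeff-+P ((a ∷ f) *P h) ((b ∷ g) *P h) zero) (cong₂ _+_ (coeff-*P a f h zero) (coeff-*P b g h zero)))))
  where lemma : ∀ h a b → (a + b) * h + + 0 ≡ (a * h + + 0) + (b * h + + 0)
        lemma = solve-∀
coeff-*P-distribʳ (a ∷ f) (b ∷ g) h (suc k) =
  trans (coeff-*P (a + b) (f +P g) h (suc k))
  (trans (cong (λ z → (a + b) * coeff h (suc k) + z) (trans (coeff-*P-distribʳ f g h k) (coeff-+P (f *P h) (g *P h) k)))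
  (trans (lemma (coeff h (suc k)) a b (coeff (f *P h) k) (coeff (g *P h) k))
  (sym (trans (coeff-+P ((a ∷ f) *P h) ((b ∷ g) *P h) (suc k)) (cong₂ _+_ (coeff-*P a f h (suc k)) (coeff-*P b g h (suc k)))))))
  where lemma : ∀ h a b x y → (a + b) * h + (x + y) ≡ (a * h + x) + (b * h + y)
        lemma = solve-∀

*P-distribʳ : ∀ f g h → ((f +P g) *P h) ≐ ((f *P h) +P (g *P h))
*P-distribʳ f g h = mk≐ (coeff-*P-distribʳ f g h)

coeff-scale-*Pˡ : ∀ c f g k → coeff (scale c f *P g) k ≡ coeff (scale c (f *P g)) k
coeff-scale-*Pˡ c [] g k = sym (trans (coeff-scale c [] k) (ℤ.*-zeroʳ c))
coeff-scale-*Pˡ c (a ∷ f) g zero =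
  trans (coeff-*P (c * a) (scale c f) g zero)
  (trans (lemma c a (coeff g zero)) (sym (trans (coeff-scale c ((a ∷ f) *P g) zero) (cong (c *_) (coeff-*P a f g zero)))))
  where lemma : ∀ c a x → c * a * x + + 0 ≡ c * (a * x + + 0)
        lemma = solve-∀
coeff-scale-*Pˡ c (a ∷ f) g (suc k) =
  trans (coeff-*P (c * a) (scale c f) g (suc k))
  (trans (cong (λ z → c * a * coeff g (suc k) + z) (trans (coeff-scale-*Pˡ c f g k) (coeff-scale c (f *P g) k)))
  (trans (lemma c a (coeff g (suc k)) (coeff (f *P g) k))
  (sym (trans (coeff-scale c ((a ∷ f) *P g) (suc k)) (cong (c *_) (coeff-*P a f g (suc k)))))))
  where lemma : ∀ c a x y → c * a * x + c * y ≡ c * (a * x + y)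
        lemma = solve-∀

scale-*Pˡ : ∀ c f g → (scale c f *P g) ≐ scale c (f *P g)
scale-*Pˡ c f g = mk≐ (coeff-scale-*Pˡ c f g)

coeff-scale-*Pʳ : ∀ c f g k → coeff (f *P scale c g) k ≡ coeff (scale c (f *P g)) k
coeff-scale-*Pʳ c [] g k = sym (trans (coeff-scale c [] k) (ℤ.*-zeroʳ c))
coeff-scale-*Pʳ c (a ∷ f) g zero =
  trans (coeff-*P a f (scale c g) zero)
  (trans (cong (λ z → a * z + + 0) (coeff-scale c g zero))
  (trans (lemma c a (coeff g zero)) (sym (trans (coeff-scale c ((a ∷ f) *P g) zero) (cong (c *_) (coeff-*P a f g zero))))))
  where lemma : ∀ c a x → a * (c * x) + + 0 ≡ c * (a * x + + 0)
        lemma = solve-∀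
coeff-scale-*Pʳ c (a ∷ f) g (suc k) =
  trans (coeff-*P a f (scale c g) (suc k))
  (trans (cong₂ (λ z w → a * z + w) (coeff-scale c g (suc k)) (trans (coeff-scale-*Pʳ c f g k) (coeff-scale c (f *P g) k)))
  (trans (lemma c a (coeff g (suc k)) (coeff (f *P g) k))
  (sym (trans (coeff-scale c ((a ∷ f) *P g) (suc k)) (cong (c *_) (coeff-*P a f g (suc k)))))))
  where lemma : ∀ c a x y → a * (c * x) + c * y ≡ c * (a * x + y)
        lemma = solve-∀

scale-*Pʳ : ∀ c f g → (f *P scale c g) ≐ scale c (f *P g)
scale-*Pʳ c f g = mk≐ (coeff-scale-*Pʳ c f g)

∷0-*P : ∀ f g → ((+ 0 ∷ f) *P g) ≐ (+ 0 ∷ (f *P g))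
∷0-*P f g = mk≐ λ k → trans (coeff-*P (+ 0) f g k) (trans (cong (_+ coeff (+ 0 ∷ (f *P g)) k) (ℤ.*-zeroˡ (coeff g k))) (ℤ.+-identityˡ _))

coeff-*P-zeroʳ : ∀ f k → coeff (f *P []) k ≡ + 0
coeff-*P-zeroʳ [] k = refl
coeff-*P-zeroʳ (a ∷ f) zero = trans (coeff-*P a f [] zero) (trans (cong (_+ + 0) (ℤ.*-zeroʳ a)) refl)
coeff-*P-zeroʳ (a ∷ f) (suc k) = trans (coeff-*P a f [] (suc k)) (trans (cong₂ _+_ (ℤ.*-zeroʳ a) (coeff-*P-zeroʳ f k)) refl)

*P-zeroʳ : ∀ f → (f *P []) ≐ []
*P-zeroʳ f = mk≐ (coeff-*P-zeroʳ f)

coeff-*P-∷ʳ : ∀ f b g k → coeff (f *P (b ∷ g)) k ≡ coeff (scale b f +P (+ 0 ∷ (f *P g))) k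
coeff-*P-∷ʳ [] b g zero = refl
coeff-*P-∷ʳ [] b g (suc k) = refl
coeff-*P-∷ʳ (a ∷ f) b g zero =
  trans (coeff-*P a f (b ∷ g) zero)
  (trans (lemma a b) (sym (trans (coeff-+P (scale b (a ∷ f)) (+ 0 ∷ ((a ∷ f) *P g)) zero) refl)))
  where lemma : ∀ a b → a * b + + 0 ≡ b * a + + 0
        lemma = solve-∀
coeff-*P-∷ʳ (a ∷ f) b g (suc k) =
  trans (coeff-*P a f (b ∷ g) (suc k))
  (trans (cong (λ z → a * coeff g k + z) (trans (coeff-*P-∷ʳ f b g k) (coeff-+P (scale b f) (+ 0 ∷ (f *P g)) k)))
  (trans (cong (λ z → a * coeff g k + (z + coeff (+ 0 ∷ (f *P g)) k)) (coeff-scale b f k))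
  (trans (lemma a (coeff g k) b (coeff f k) (coeff (+ 0 ∷ (f *P g)) k))
  (sym (trans (coeff-+P (scale b (a ∷ f)) (+ 0 ∷ ((a ∷ f) *P g)) (suc k))
        (cong₂ _+_ (coeff-scale b f k) (coeff-*P a f g k)))))))
  where lemma : ∀ a x b y z → a * x + (b * y + z) ≡ b * y + (a * x + z)
        lemma = solve-∀

*P-∷ʳ : ∀ f b g → (f *P (b ∷ g)) ≐ (scale b f +P (+ 0 ∷ (f *P g)))
*P-∷ʳ f b g = mk≐ (coeff-*P-∷ʳ f b g)

*P-comm : ∀ f g → (f *P g) ≐ (g *P f)
*P-comm [] g = ≐-sym (*P-zeroʳ g)
*P-comm (a ∷ f) g = ≐-sym (≐-trans (*P-∷ʳ g a f) (+P-cong {scale a g} ≐-refl (≐-cons {+ 0} refl (*P-comm g f))))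

*P-assoc : ∀ f g h → ((f *P g) *P h) ≐ (f *P (g *P h))
*P-assoc [] g h = ≐-refl
*P-assoc (a ∷ f) g h =
  ≐-trans (*P-distribʳ (scale a g) (+ 0 ∷ (f *P g)) h)
    (+P-cong (scale-*Pˡ a g h)
      (≐-trans (∷0-*P (f *P g) h) (≐-cons refl (*P-assoc f g h))))

*P-distribˡ : ∀ h f g → (h *P (f +P g)) ≐ ((h *P f) +P (h *P g))
*P-distribˡ h f g =
  ≐-trans (*P-comm h (f +P g)) (≐-trans (*P-distribʳ f g h) (+P-cong (*P-comm f h) (*P-comm g h)))

shift : ℕ → Poly → Poly
shift zero P = P
shift (suc m) P = + 0 ∷ shift m P

replicate0++≡shift : ∀ n X → replicate n (+ 0) ++ X ≡ shift n X
replicate0++≡shift zero X = refl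
replicate0++≡shift (suc n) X = cong (+ 0 ∷_) (replicate0++≡shift n X)

coeff-shift-< : ∀ m P k → k ℕ.< m → coeff (shift m P) k ≡ + 0
coeff-shift-< (suc m) P zero _ = refl
coeff-shift-< (suc m) P (suc k) (ℕ.s≤s p) = coeff-shift-< m P k p

coeff-shift-+ : ∀ m P k → coeff (shift m P) (m ℕ.+ k) ≡ coeff P k
coeff-shift-+ zero P k = refl
coeff-shift-+ (suc m) P k = coeff-shift-+ m P k

shift-*P : ∀ m P Q → (shift m P *P Q) ≐ shift m (P *P Q)
shift-*P zero P Q = ≐-refl
shift-*P (suc m) P Q = ≐-trans (∷0-*P (shift m P) Q) (≐-cons refl (shift-*P m P Q))

coeff-≥length : ∀ P k → length P ℕ.≤ k → coeff P k ≡ + 0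
coeff-≥length [] k _ = refl
coeff-≥length (a ∷ P) (suc k) (ℕ.s≤s h) = coeff-≥length P k h

coeff-shift-≥ : ∀ m P k → m ℕ.≤ k → coeff (shift m P) k ≡ coeff P (k ℕ.∸ m)
coeff-shift-≥ m P k le = trans (cong (coeff (shift m P)) (sym (ℕ.m+[n∸m]≡n le))) (coeff-shift-+ m P (k ℕ.∸ m))

_-P_ : Poly → Poly → Poly
f -P g = f +P scale (- + 1) g

coeff--P : ∀ f g k → coeff (f -P g) k ≡ coeff f k - coeff g k
coeff--P f g k = trans (coeff-+P f (scale (- + 1) g) k) (trans (cong (λ z → coeff f k + z) (coeff-scale (- + 1) g k)) (lemma (coeff f k) (coeff g k)))
  where lemma : ∀ a b → a + (- + 1) * b ≡ a - b
        lemma = solve-∀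

shift-cong : ∀ m {P P'} → P ≐ P' → shift m P ≐ shift m P'
shift-cong zero e = e
shift-cong (suc m) e = ≐-cons refl (shift-cong m e)

[c]-*P : ∀ c g → ((c ∷ []) *P g) ≐ scale c g
[c]-*P c g = mk≐ λ k → trans (coeff-*P c [] g k) (trans (no-tail k) (sym (coeff-scale c g k)))
  where no-tail : ∀ k → c * coeff g k + coeff (+ 0 ∷ []) k ≡ c * coeff g k
        no-tail zero = ℤ.+-identityʳ _
        no-tail (suc k) = ℤ.+-identityʳ _

-P-+P : ∀ P T → ((P -P T) +P T) ≐ P
-P-+P P T = mk≐ λ k → trans (coeff-+P (P -P T) T k) (trans (cong (λ z → z + coeff T k) (coeff--P P T k)) (lemma (coeff P k) (coeff T k)))
  where lemma : ∀ a b → a - b + b ≡ a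
        lemma = solve-∀

+P--P : ∀ A S → ((A +P S) -P A) ≐ S
+P--P A S = mk≐ λ k → trans (coeff--P (A +P S) A k) (trans (cong (λ z → z - coeff A k) (coeff-+P A S k)) (lemma (coeff A k) (coeff S k)))
  where lemma : ∀ a s → a + s - a ≡ s
        lemma = solve-∀

*P--Pˡ : ∀ f g h → ((f -P g) *P h) ≐ ((f *P h) -P (g *P h))
*P--Pˡ f g h = ≐-trans (*P-distribʳ f (scale (- + 1) g) h) (+P-cong {f *P h} ≐-refl (scale-*Pˡ (- + 1) g h))

*P--Pʳ : ∀ h f g → (h *P (f -P g)) ≐ ((h *P f) -P (h *P g))
*P--Pʳ h f g = ≐-trans (*P-distribˡ h f (scale (- + 1) g)) (+P-cong {h *P f} ≐-refl (scale-*Pʳ (- + 1) h g))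


xⁿ-c≡shift : ∀ n c → xⁿ-c n c ≡ (shift n (+ 1 ∷ []) +P (- c ∷ []))
xⁿ-c≡shift n c = cong (λ z → z +P (- c ∷ [])) (replicate0++≡shift n (+ 1 ∷ []))

scale-1 : ∀ w → scale (+ 1) w ≐ w
scale-1 w = mk≐ λ k → trans (coeff-scale (+ 1) w k) (ℤ.*-identityˡ _)

xⁿ-c-*P : ∀ n c w → (xⁿ-c n c *P w) ≐ (shift n w +P scale (- c) w)
xⁿ-c-*P n c w rewrite xⁿ-c≡shift n c =
  ≐-trans (*P-distribʳ (shift n (+ 1 ∷ [])) (- c ∷ []) w)
    (+P-cong (≐-trans (shift-*P n (+ 1 ∷ []) w) (shift-cong n (≐-trans ([c]-*P (+ 1) w) (scale-1 w))))
             ([c]-*P (- c) w))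

coeff-xⁿ-c-*P-+ : ∀ n c w m → coeff (xⁿ-c n c *P w) (n ℕ.+ m) ≡ coeff w m - c * coeff w (n ℕ.+ m)
coeff-xⁿ-c-*P-+ n c w m = trans (at≐ (xⁿ-c-*P n c w) (n ℕ.+ m))
  (trans (coeff-+P (shift n w) (scale (- c) w) (n ℕ.+ m))
  (trans (cong₂ _+_ (coeff-shift-+ n w m) (coeff-scale (- c) w (n ℕ.+ m))) (lemma (coeff w m) c (coeff w (n ℕ.+ m)))))
  where lemma : ∀ a c b → a + (- c) * b ≡ a - c * b
        lemma = solve-∀

coeff-xⁿ-c-*P-< : ∀ n c w k → k ℕ.< n → coeff (xⁿ-c n c *P w) k ≡ - c * coeff w k
coeff-xⁿ-c-*P-< n c w k lt = trans (at≐ (xⁿ-c-*P n c w) k)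
  (trans (coeff-+P (shift n w) (scale (- c) w) k)
  (trans (cong₂ _+_ (coeff-shift-< n w k lt) (coeff-scale (- c) w k)) (ℤ.+-identityˡ _)))

coeff-xⁿ-c-n : ∀ n c → 1 ℕ.≤ n → coeff (xⁿ-c n c) n ≡ + 1
coeff-xⁿ-c-n (suc n) c _ = trans (cong (λ z → coeff z (suc n)) (xⁿ-c≡shift (suc n) c)) (
  trans (coeff-+P (shift (suc n) (+ 1 ∷ [])) (- c ∷ []) (suc n))
    (trans (cong₂ _+_ (trans (cong (coeff (shift (suc n) (+ 1 ∷ []))) (sym (ℕ.+-identityʳ (suc n)))) (coeff-shift-+ (suc n) (+ 1 ∷ []) zero)) refl) refl))

+P-identityʳ : ∀ X → (X +P []) ≐ X
+P-identityʳ X = mk≐ λ k → trans (coeff-+P X [] k) (ℤ.+-identityʳ _)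

module Modulo (p : ℕ) (p-prime : Prime p) where

  infix 4 p∣_
  p∣_ : ℤ → Set
  p∣ x = + p S.∣ x

  p∣? : ∀ x → Dec (p∣ x)
  p∣? x = + p S.∣? x

  p∣0 : p∣ + 0
  p∣0 = divides (+ 0) refl

  p∣x-x : ∀ x → p∣ (x - x)
  p∣x-x x = subst p∣_ (sym (ℤ.+-inverseʳ x)) p∣0

  p∤1 : ¬ p∣ + 1
  p∤1 p∣1 = ℕ.<⇒≱ (ℕ.nonTrivial⇒n>1 p {{prime⇒nonTrivial p-prime}}) (ℕ.∣⇒≤ (∣⇒∣ᵤ p∣1))

  p∣*⇒p∣⊎p∣ : ∀ a b → p∣ (a * b) → p∣ a ⊎ p∣ b
  p∣*⇒p∣⊎p∣ a b p∣ab with euclidsLemma ℤ.∣ a ∣ ℤ.∣ b ∣ p-prime (subst (p ℕ.∣_) (ℤ.abs-* a b) (∣⇒∣ᵤ p∣ab))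
  ... | inj₁ p∣a = inj₁ (∣ᵤ⇒∣ p∣a)
  ... | inj₂ p∣b = inj₂ (∣ᵤ⇒∣ p∣b)

  p∤* : ∀ {a b} → ¬ p∣ a → ¬ p∣ b → ¬ p∣ (a * b)
  p∤* p∤a p∤b p∣ab with p∣*⇒p∣⊎p∣ _ _ p∣ab
  ... | inj₁ p∣a = p∤a p∣a
  ... | inj₂ p∣b = p∤b p∣b

  p∣*-cancelˡ : ∀ {a} b → ¬ p∣ a → p∣ (a * b) → p∣ b
  p∣*-cancelˡ {a} b p∤a p∣ab with p∣*⇒p∣⊎p∣ a b p∣ab
  ... | inj₁ p∣a = ⊥-elim (p∤a p∣a)
  ... | inj₂ p∣b = p∣b

  p∣⇒p∣^ : ∀ {a} k → .{{ℕ.NonZero k}} → p∣ a → p∣ (a ^ k)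
  p∣⇒p∣^ {a} (suc k) p∣a = ∣m⇒∣m*n (a ^ k) p∣a

  p∤^ : ∀ {a} k → ¬ p∣ a → ¬ p∣ (a ^ k)
  p∤^ zero    p∤a = p∤1
  p∤^ (suc k) p∤a = p∤* p∤a (p∤^ k p∤a)

  inverse+ : ∀ n → ¬ p∣ (+ n) → Σ ℤ λ e → p∣ (e * + n - + 1)
  inverse+ n p∤n with coprime-Bézout coprime
    where
      coprime : Coprime p n
      coprime (d∣p , d∣n) with prime⇒irreducible p-prime d∣p
      ... | inj₁ d≡1 = d≡1
      ... | inj₂ refl = ⊥-elim (p∤n (∣ᵤ⇒∣ d∣n))
  ... | Bézout.+- x y eq = - (+ y) , divides (- (+ x)) (begin
    - (+ y) * + n - + 1        ≡⟨ lemma (+ y) (+ n) ⟩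
    - (+ 1 + + y * + n)        ≡⟨ cong (λ z → - (+ 1 + z)) (sym (ℤ.pos-* y n)) ⟩
    - (+ 1 + + (y ℕ.* n))      ≡⟨ cong -_ (sym (ℤ.pos-+ 1 (y ℕ.* n))) ⟩
    - (+ (1 ℕ.+ y ℕ.* n))      ≡⟨ cong (λ z → - (+ z)) eq ⟩
    - (+ (x ℕ.* p))            ≡⟨ cong -_ (ℤ.pos-* x p) ⟩
    - (+ x * + p)              ≡⟨ ℤ.neg-distribˡ-* (+ x) (+ p) ⟩
    - (+ x) * + p              ∎)
    where open ≡-Reasoning
          lemma : ∀ a b → - a * b - + 1 ≡ - (+ 1 + a * b)
          lemma = solve-∀
  ... | Bézout.-+ x y eq = + y , divides (+ x) (begin
    + y * + n - + 1            ≡⟨ cong (_- + 1) (sym (ℤ.pos-* y n)) ⟩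
    + (y ℕ.* n) - + 1          ≡⟨ cong (λ z → + z - + 1) (sym eq) ⟩
    + (1 ℕ.+ x ℕ.* p) - + 1    ≡⟨ cong (_- + 1) (ℤ.pos-+ 1 (x ℕ.* p)) ⟩
    + 1 + + (x ℕ.* p) - + 1    ≡⟨ lemma (+ (x ℕ.* p)) ⟩
    + (x ℕ.* p)                ≡⟨ ℤ.pos-* x p ⟩
    + x * + p                  ∎)
    where open ≡-Reasoning
          lemma : ∀ a → + 1 + a - + 1 ≡ a
          lemma = solve-∀

  inverse : ∀ a → ¬ p∣ a → Σ ℤ λ e → p∣ (e * a - + 1)
  inverse (+ n)       p∤n = inverse+ n p∤n
  inverse (ℤ.-[1+ n ]) p∤a with inverse+ (suc n) (λ p∣n → p∤a (∣m⇒∣-m p∣n))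
  ... | e , e⁻¹ = - e , subst p∣_ (lemma e (+ suc n)) e⁻¹
    where lemma : ∀ e a → e * a - + 1 ≡ - e * (- a) - + 1
          lemma = solve-∀

  p∣sumFin : ∀ n (f : Fin n → ℤ) → (∀ j → p∣ f j) → p∣ sumFin n f
  p∣sumFin zero    f p∣f = p∣0
  p∣sumFin (suc n) f p∣f = ∣m∣n⇒∣m+n (p∣f fz) (p∣sumFin n (λ j → f (fs j)) (λ j → p∣f (fs j)))

  sumFin-- : ∀ n (f g : Fin n → ℤ) → sumFin n (λ j → f j - g j) ≡ sumFin n f - sumFin n g
  sumFin-- n f g = trans (sumFin-+ n f (λ j → - g j)) (cong (_+_ (sumFin n f)) (sumFin-neg n g))

  KernelVector : ∀ n → Matrix n → Set
  KernelVector n A =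
    Σ (Fin n → ℤ) λ v → (∃ λ j → ¬ p∣ v j) × (∀ i → p∣ sumFin n (λ j → A i j * v j))

  -- Adding row i to row 0 makes the pivot a unit, changes neither det nor the kernel modulo p.
  nonzeroPivot : ∀ m (A : Matrix (suc m)) (i : Fin (suc m)) → ¬ p∣ A i fz → p∣ det (suc m) A →
    Σ (Matrix (suc m)) λ A′ → ¬ p∣ A′ fz fz × p∣ det (suc m) A′ × (KernelVector (suc m) A′ → KernelVector (suc m) A)
  nonzeroPivot m A i p∤Ai0 p∣detA with p∣? (A fz fz)
  ... | no p∤A00 = A , p∤A00 , p∣detA , (λ v → v)
  nonzeroPivot m A fz     p∤Ai0 p∣detA | yes p∣A00 = ⊥-elim (p∤Ai0 p∣A00)
  nonzeroPivot m A (fs i) p∤Ai0 p∣detA | yes p∣A00 = A′ , p∤A′00 , p∣detA′ , back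
    where
      open ≡-Reasoning
      A′ : Matrix (suc m)
      A′ fz     l = A fz l + A (fs i) l
      A′ (fs k) l = A (fs k) l
      C : Matrix (suc m)
      C = replaceRow fz (A (fs i)) A
      p∤A′00 : ¬ p∣ A′ fz fz
      p∤A′00 p∣A′00 = p∤Ai0 (subst p∣_ (cancel (A fz fz) (A (fs i) fz)) (∣m∣n⇒∣m-n p∣A′00 p∣A00))
        where cancel : ∀ a b → a + b - a ≡ b
              cancel = solve-∀
      detA′ : det (suc m) A′ ≡ det (suc m) A
      detA′ = begin
        det (suc m) A′                              ≡⟨ det-linear (suc m) A′ A C fz (+ 1) (+ 1) others row₀ ⟩
        + 1 * det (suc m) A + + 1 * det (suc m) C   ≡⟨ cong (λ z → + 1 * det (suc m) A + + 1 * z) (det-repeatedRow₀ m C i (λ _ → refl)) ⟩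
        + 1 * det (suc m) A + + 1 * + 0             ≡⟨ lemma (det (suc m) A) ⟩
        det (suc m) A                               ∎
        where
          others : ∀ k → k ≢ fz → ∀ l → (A k l ≡ A′ k l) × (C k l ≡ A′ k l)
          others fz     k≢0 l = ⊥-elim (k≢0 refl)
          others (fs k) k≢0 l = refl , refl
          row₀ : ∀ l → A′ fz l ≡ + 1 * A fz l + + 1 * C fz l
          row₀ l = sym (trans (cong₂ _+_ (ℤ.*-identityˡ (A fz l)) (ℤ.*-identityˡ (A (fs i) l))) refl)
          lemma : ∀ d → + 1 * d + + 1 * + 0 ≡ d
          lemma = solve-∀
      p∣detA′ : p∣ det (suc m) A′
      p∣detA′ = subst p∣_ (sym detA′) p∣detA
      back : KernelVector (suc m) A′ → KernelVector (suc m) A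
      back (v , nonzero , A′v≡0) = v , nonzero , Av≡0
        where
          Av≡0 : ∀ r → p∣ sumFin (suc m) (λ j → A r j * v j)
          Av≡0 fz     = subst p∣_ row₀ (∣m∣n⇒∣m-n (A′v≡0 fz) (A′v≡0 (fs i)))
            where
              row₀ : sumFin (suc m) (λ j → A′ fz j * v j) - sumFin (suc m) (λ j → A (fs i) j * v j)
                     ≡ sumFin (suc m) (λ j → A fz j * v j)
              row₀ = trans (sym (sumFin-- (suc m) (λ j → A′ fz j * v j) (λ j → A (fs i) j * v j)))
                           (sumFin-cong (suc m) (λ j → lemma (A fz j) (A (fs i) j) (v j)))
                where lemma : ∀ a b x → (a + b) * x - b * x ≡ a * x
                      lemma = solve-∀
          Av≡0 (fs k) = A′v≡0 (fs k)

  -- Clearing the first column below a unit pivot c multiplies det by c^m, and the result is c times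
  -- the determinant of the remaining block; a kernel vector of that block lifts to one of A.
  module ClearColumn₀ (m : ℕ) (A : Matrix (suc m)) (p∤c : ¬ p∣ A fz fz) where

    c : ℤ
    c = A fz fz

    cleared : Matrix (suc m)
    cleared fz     l = A fz l
    cleared (fs i) l = c * A (fs i) l + (- A (fs i) fz) * A fz l

    block : Matrix m
    block = minor cleared fz

    column₀-cleared : ∀ i → cleared (fs i) fz ≡ + 0
    column₀-cleared i = lemma c (A (fs i) fz)
      where lemma : ∀ c a → c * a + (- a) * c ≡ + 0
            lemma = solve-∀

    p∣det-block : p∣ det (suc m) A → p∣ det m block
    p∣det-block p∣detA = p∣*-cancelˡ (det m block) p∤c (subst p∣_ det-cleared (∣n⇒∣m*n (c ^ m) p∣detA))
      where
        det-cleared : c ^ m * det (suc m) A ≡ c * det m block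
        det-cleared = trans (sym (det-eliminate m A cleared c (λ i → - A (fs i) fz) (λ _ → refl) (λ _ _ → refl)))
                            (det-firstColumn m cleared column₀-cleared)

    liftKernelVector : KernelVector m block → KernelVector (suc m) A
    liftKernelVector (u , (j , p∤uj) , block-u≡0) = v , (fs j , p∤* p∤c p∤uj) , Av≡0
      where
        open ≡-Reasoning
        S : ℤ
        S = sumFin m (λ k → A fz (fs k) * u k)
        v : Fin (suc m) → ℤ
        v fz     = - S
        v (fs k) = c * u k
        pull-c : ∀ (f : Fin m → ℤ) → sumFin m (λ k → f k * (c * u k)) ≡ c * sumFin m (λ k → f k * u k)
        pull-c f = trans (sumFin-cong m (λ k → lemma (f k) c (u k))) (sumFin-*ˡ m c (λ k → f k * u k))
          where lemma : ∀ a c x → a * (c * x) ≡ c * (a * x)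
                lemma = solve-∀
        row₀ : sumFin (suc m) (λ j → A fz j * v j) ≡ + 0
        row₀ = trans (cong (_+_ (c * - S)) (pull-c (λ k → A fz (fs k)))) (lemma c S)
          where lemma : ∀ c s → c * (- s) + c * s ≡ + 0
                lemma = solve-∀
        cleared-row : ∀ i → sumFin (suc m) (λ j → cleared (fs i) j * v j) ≡ c * sumFin m (λ k → block i k * u k)
        cleared-row i = begin
          cleared (fs i) fz * v fz + sumFin m (λ k → block i k * (c * u k))
            ≡⟨ cong₂ _+_ (trans (cong (_* v fz) (column₀-cleared i)) (ℤ.*-zeroˡ (v fz))) (pull-c (block i)) ⟩
          + 0 + c * sumFin m (λ k → block i k * u k)
            ≡⟨ ℤ.+-identityˡ _ ⟩
          c * sumFin m (λ k → block i k * u k) ∎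
        Av≡0 : ∀ r → p∣ sumFin (suc m) (λ j → A r j * v j)
        Av≡0 fz     = subst p∣_ (sym row₀) p∣0
        Av≡0 (fs i) = p∣*-cancelˡ _ p∤c (subst p∣_ (sym expand)
                        (∣m∣n⇒∣m+n (subst p∣_ (sym (cleared-row i)) (∣n⇒∣m*n c (block-u≡0 i)))
                                   (∣n⇒∣m*n (A (fs i) fz) (subst p∣_ (sym row₀) p∣0))))
          where
            expand : c * sumFin (suc m) (λ j → A (fs i) j * v j)
                     ≡ sumFin (suc m) (λ j → cleared (fs i) j * v j) + A (fs i) fz * sumFin (suc m) (λ j → A fz j * v j)
            expand = begin
              c * sumFin (suc m) (λ j → A (fs i) j * v j)
                ≡⟨ sym (sumFin-*ˡ (suc m) c (λ j → A (fs i) j * v j)) ⟩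
              sumFin (suc m) (λ j → c * (A (fs i) j * v j))
                ≡⟨ sumFin-cong (suc m) (λ j → lemma c (A (fs i) j) (A (fs i) fz) (A fz j) (v j)) ⟩
              sumFin (suc m) (λ j → cleared (fs i) j * v j + A (fs i) fz * (A fz j * v j))
                ≡⟨ sumFin-+ (suc m) (λ j → cleared (fs i) j * v j) (λ j → A (fs i) fz * (A fz j * v j)) ⟩
              sumFin (suc m) (λ j → cleared (fs i) j * v j) + sumFin (suc m) (λ j → A (fs i) fz * (A fz j * v j))
                ≡⟨ cong (_+_ (sumFin (suc m) (λ j → cleared (fs i) j * v j))) (sumFin-*ˡ (suc m) (A (fs i) fz) (λ j → A fz j * v j)) ⟩
              sumFin (suc m) (λ j → cleared (fs i) j * v j) + A (fs i) fz * sumFin (suc m) (λ j → A fz j * v j) ∎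
              where lemma : ∀ c r r₀ a x → c * (r * x) ≡ (c * r + (- r₀) * a) * x + r₀ * (a * x)
                    lemma = solve-∀

  p∣det⇒kernelVector : ∀ n (A : Matrix n) → p∣ det n A → KernelVector n A
  p∣det⇒kernelVector zero    A p∣1 = ⊥-elim (p∤1 p∣1)
  p∣det⇒kernelVector (suc m) A p∣detA with any? (λ i → ¬? (p∣? (A i fz)))
  ... | yes (i , p∤Ai0) with nonzeroPivot m A i p∤Ai0 p∣detA
  ...   | A′ , p∤A′00 , p∣detA′ , back = back (liftKernelVector (p∣det⇒kernelVector m block (p∣det-block p∣detA′)))
    where open ClearColumn₀ m A′ p∤A′00
  p∣det⇒kernelVector (suc m) A p∣detA | no no-unit-in-column₀ = e₀ , (fz , p∤1) , Ae₀≡0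
    where
      e₀ : Fin (suc m) → ℤ
      e₀ fz     = + 1
      e₀ (fs _) = + 0
      p∣column₀ : ∀ i → p∣ A i fz
      p∣column₀ i with p∣? (A i fz)
      ... | yes p∣Ai0 = p∣Ai0
      ... | no  p∤Ai0 = ⊥-elim (no-unit-in-column₀ (i , p∤Ai0))
      Ae₀≡0 : ∀ i → p∣ sumFin (suc m) (λ j → A i j * e₀ j)
      Ae₀≡0 i = ∣m∣n⇒∣m+n (∣m⇒∣m*n (+ 1) (p∣column₀ i))
                          (p∣sumFin m (λ j → A i (fs j) * + 0) (λ j → subst p∣_ (sym (ℤ.*-zeroʳ (A i (fs j)))) p∣0))

  p∣entries⇒pⁿ∣det : ∀ n (A : Matrix n) → (∀ i j → p∣ A i j) → ((+ p) ^ n) S.∣ det n A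
  p∣entries⇒pⁿ∣det zero    A p∣A = divides (+ 1) refl
  p∣entries⇒pⁿ∣det (suc n) A p∣A = pⁿ∣sumFin (suc n) (laplaceTerm n A) term
    where
      pⁿ∣sumFin : ∀ k (f : Fin k → ℤ) → (∀ j → ((+ p) ^ suc n) S.∣ f j) → ((+ p) ^ suc n) S.∣ sumFin k f
      pⁿ∣sumFin zero    f pⁿ∣f = divides (+ 0) refl
      pⁿ∣sumFin (suc k) f pⁿ∣f = ∣m∣n⇒∣m+n (pⁿ∣f fz) (pⁿ∣sumFin k (λ j → f (fs j)) (λ j → pⁿ∣f (fs j)))
      term : ∀ j → ((+ p) ^ suc n) S.∣ laplaceTerm n A j
      term j with p∣A fz j | p∣entries⇒pⁿ∣det n (minor A j) (λ i l → p∣A (fs i) (punchIn j l))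
      ... | divides q₁ e₁ | divides q₂ e₂ = divides (sign (toℕ j) * q₁ * q₂)
            (trans (cong₂ (λ x y → sign (toℕ j) * x * y) e₁ e₂) (lemma (sign (toℕ j)) q₁ q₂ (+ p) ((+ p) ^ n)))
        where lemma : ∀ s a b p pn → s * (a * p) * (b * pn) ≡ s * a * b * (p * pn)
              lemma = solve-∀

  det-cong-mod : ∀ n (A B : Matrix n) → (∀ i j → p∣ (A i j - B i j)) → p∣ (det n A - det n B)
  det-cong-mod zero    A B A≡B = p∣x-x (+ 1)
  det-cong-mod (suc n) A B A≡B =
    subst p∣_ (sumFin-- (suc n) (laplaceTerm n A) (laplaceTerm n B))
      (p∣sumFin (suc n) (λ j → laplaceTerm n A j - laplaceTerm n B j) λ j →
        subst p∣_ (sym (lemma (sign (toℕ j)) (A fz j) (B fz j) (det n (minor A j)) (det n (minor B j))))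
          (∣m∣n⇒∣m+n (∣m⇒∣m*n (det n (minor A j)) (∣n⇒∣m*n (sign (toℕ j)) (A≡B fz j)))
                     (∣n⇒∣m*n (sign (toℕ j) * B fz j)
                              (det-cong-mod n (minor A j) (minor B j) (λ i l → A≡B (fs i) (punchIn j l))))))
    where lemma : ∀ s a b da db → s * a * da - s * b * db ≡ s * (a - b) * da + s * b * (da - db)
          lemma = solve-∀

  infix 4 _≡ₚ_
  record _≡ₚ_ (a b : ℤ) : Set where
    constructor mkₚ
    field p∣- : p∣ (a - b)
  open _≡ₚ_ public

  ≡ₚ-refl : ∀ {a} → a ≡ₚ a
  ≡ₚ-refl {a} = mkₚ (p∣x-x a)

  ≡⇒≡ₚ : ∀ {a b} → a ≡ b → a ≡ₚ b
  ≡⇒≡ₚ refl = ≡ₚ-refl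

  ≡ₚ-sym : ∀ {a b} → a ≡ₚ b → b ≡ₚ a
  ≡ₚ-sym {a} {b} (mkₚ p∣a-b) = mkₚ (subst p∣_ (lemma a b) (∣m⇒∣-m p∣a-b))
    where lemma : ∀ a b → - (a - b) ≡ b - a
          lemma = solve-∀

  ≡ₚ-trans : ∀ {a b c} → a ≡ₚ b → b ≡ₚ c → a ≡ₚ c
  ≡ₚ-trans {a} {b} {c} (mkₚ p∣a-b) (mkₚ p∣b-c) = mkₚ (subst p∣_ (lemma a b c) (∣m∣n⇒∣m+n p∣a-b p∣b-c))
    where lemma : ∀ a b c → (a - b) + (b - c) ≡ a - c
          lemma = solve-∀

  ≡ₚ-* : ∀ {a b c d} → a ≡ₚ b → c ≡ₚ d → a * c ≡ₚ b * d
  ≡ₚ-* {a} {b} {c} {d} (mkₚ p∣a-b) (mkₚ p∣c-d) =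
    mkₚ (subst p∣_ (lemma a b c d) (∣m∣n⇒∣m+n (∣m⇒∣m*n c p∣a-b) (∣n⇒∣m*n b p∣c-d)))
    where lemma : ∀ a b c d → (a - b) * c + b * (c - d) ≡ a * c - b * d
          lemma = solve-∀

  ≡ₚ-^ : ∀ {a b} k → a ≡ₚ b → a ^ k ≡ₚ b ^ k
  ≡ₚ-^ zero    a≡b = ≡ₚ-refl
  ≡ₚ-^ (suc k) a≡b = ≡ₚ-* a≡b (≡ₚ-^ k a≡b)

  ≡ₚ-isEquivalence : IsEquivalence _≡ₚ_
  ≡ₚ-isEquivalence = record { refl = ≡ₚ-refl ; sym = ≡ₚ-sym ; trans = ≡ₚ-trans }

  ≡ₚ-setoid : Setoid 0ℓ 0ℓ
  ≡ₚ-setoid = record { isEquivalence = ≡ₚ-isEquivalence }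

  module ≡ₚ-Reasoning = Relation.Binary.Reasoning.Setoid ≡ₚ-setoid

module PolynomialsModulo (p : ℕ) (p-prime : Prime p) where

  open Modulo p p-prime public

  infix 4 _≈_
  record _≈_ (f g : Poly) : Set where
    constructor mk≈
    field at≈ : ∀ k → p∣ (coeff f k - coeff g k)
  open _≈_ public

  record p∣ᴾ (Z : Poly) : Set where
    constructor mkp∣ᴾ
    field p∣coeff : ∀ k → p∣ (coeff Z k)
  open p∣ᴾ public

  record Deg< (L : ℕ) (P : Poly) : Set where
    constructor mkDeg<
    field p∣coeff-beyond : ∀ j → p∣ (coeff P (L ℕ.+ j))
  open Deg< public

  ≈-refl : ∀ {f} → f ≈ f
  ≈-refl {f} = mk≈ λ k → p∣x-x (coeff f k)

  ≈-sym : ∀ {f g} → f ≈ g → g ≈ f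
  ≈-sym {f} {g} e = mk≈ λ k → p∣- (≡ₚ-sym {coeff f k} {coeff g k} (mkₚ (at≈ e k)))

  ≈-trans : ∀ {f g h} → f ≈ g → g ≈ h → f ≈ h
  ≈-trans {f} {g} {h} e₁ e₂ = mk≈ λ k → p∣- (≡ₚ-trans {coeff f k} {coeff g k} {coeff h k} (mkₚ (at≈ e₁ k)) (mkₚ (at≈ e₂ k)))

  ≈-setoid : Setoid 0ℓ 0ℓ
  ≈-setoid = record { _≈_ = _≈_ ; isEquivalence = record { refl = ≈-refl ; sym = ≈-sym ; trans = ≈-trans } }

  module ≈-Reasoning = Relation.Binary.Reasoning.Setoid ≈-setoid

  ≐⇒≈ : ∀ {f g} → f ≐ g → f ≈ g
  ≐⇒≈ {f} {g} e = mk≈ λ k → p∣- (≡⇒≡ₚ {coeff f k} {coeff g k} (at≐ e k))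

  ≈-+P : ∀ {f f' g g'} → f ≈ f' → g ≈ g' → (f +P g) ≈ (f' +P g')
  ≈-+P {f} {f'} {g} {g'} e1 e2 = mk≈ λ k →
    subst p∣_ (sym (trans (cong₂ _-_ (coeff-+P f g k) (coeff-+P f' g' k)) (lemma (coeff f k) (coeff g k) (coeff f' k) (coeff g' k))))
        (∣m∣n⇒∣m+n (at≈ e1 k) (at≈ e2 k))
    where lemma : ∀ a b c d → (a + b) - (c + d) ≡ (a - c) + (b - d)
          lemma = solve-∀

  ≈-scale : ∀ c {f f'} → f ≈ f' → scale c f ≈ scale c f'
  ≈-scale c {f} {f'} e = mk≈ λ k →
    subst p∣_ (sym (trans (cong₂ _-_ (coeff-scale c f k) (coeff-scale c f' k)) (lemma c (coeff f k) (coeff f' k))))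
        (∣n⇒∣m*n c (at≈ e k))
    where lemma : ∀ c a b → c * a - c * b ≡ c * (a - b)
          lemma = solve-∀

  p∣ᴾ-*Pˡ : ∀ Z Q → p∣ᴾ Z → p∣ᴾ (Z *P Q)
  p∣ᴾ-*Pˡ [] Q d = mkp∣ᴾ λ k → p∣0
  p∣ᴾ-*Pˡ (a ∷ Z) Q d = mkp∣ᴾ λ k → subst p∣_ (sym (coeff-*P a Z Q k)) (∣m∣n⇒∣m+n (∣m⇒∣m*n (coeff Q k) (p∣coeff d zero)) (shifted k))
    where shifted : ∀ k → p∣ (coeff (+ 0 ∷ (Z *P Q)) k)
          shifted zero = p∣0
          shifted (suc k) = p∣coeff (p∣ᴾ-*Pˡ Z Q (mkp∣ᴾ λ j → p∣coeff d (suc j))) k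

  ≈-*Pˡ : ∀ {f f'} Q → f ≈ f' → (f *P Q) ≈ (f' *P Q)
  ≈-*Pˡ {f} {f'} Q e = mk≈ λ k →
    subst p∣_ (trans (at≐ eq k) (coeff--P (f *P Q) (f' *P Q) k)) (p∣coeff (p∣ᴾ-*Pˡ (f -P f') Q (mkp∣ᴾ λ j → subst p∣_ (sym (coeff--P f f' j)) (at≈ e j))) k)
    where
      eq : ((f -P f') *P Q) ≐ ((f *P Q) -P (f' *P Q))
      eq = ≐-trans (*P-distribʳ f (scale (- + 1) f') Q) (+P-cong {f *P Q} ≐-refl (scale-*Pˡ (- + 1) f' Q))

  ≈-*Pʳ : ∀ f {g g'} → g ≈ g' → (f *P g) ≈ (f *P g')
  ≈-*Pʳ f {g} {g'} e = ≈-trans (≐⇒≈ (*P-comm f g)) (≈-trans (≈-*Pˡ f e) (≐⇒≈ (*P-comm g' f)))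

  Deg<-len : ∀ P → Deg< (length P) P
  Deg<-len P = mkDeg< λ j → subst p∣_ (sym (coeff-≥length P (length P ℕ.+ j) (ℕ.m≤m+n _ _))) p∣0

  Deg<-mono : ∀ {L L' P} → L ℕ.≤ L' → Deg< L P → Deg< L' P
  Deg<-mono {L} {L'} {P} le d = mkDeg< λ j →
    subst (λ z → p∣ (coeff P z)) (trans (sym (ℕ.+-assoc L (L' ℕ.∸ L) j)) (cong (ℕ._+ j) (ℕ.m+[n∸m]≡n le)))
          (p∣coeff-beyond d (L' ℕ.∸ L ℕ.+ j))

  Deg<-at : ∀ {L P} k → L ℕ.≤ k → Deg< L P → p∣ (coeff P k)
  Deg<-at {L} {P} k le d = subst (λ z → p∣ (coeff P z)) (ℕ.m+[n∸m]≡n le) (p∣coeff-beyond d (k ℕ.∸ L))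

  Deg<-≈ : ∀ {L P P'} → P ≈ P' → Deg< L P → Deg< L P'
  Deg<-≈ {L} {P} {P'} e d = mkDeg< λ j → subst p∣_ (lemma (coeff P (L ℕ.+ j)) (coeff P' (L ℕ.+ j))) (∣m∣n⇒∣m-n (p∣coeff-beyond d j) (at≈ e (L ℕ.+ j)))
    where lemma : ∀ a b → a - (a - b) ≡ b
          lemma = solve-∀

  degree-or-p∣ᴾ : ∀ d S → Deg< d S → p∣ᴾ S ⊎ Σ ℕ λ d' → (d' ℕ.< d) × Deg< (suc d') S × ¬ p∣ (coeff S d')
  degree-or-p∣ᴾ zero S h = inj₁ (mkp∣ᴾ λ k → p∣coeff-beyond h k)
  degree-or-p∣ᴾ (suc d) S h with p∣? (coeff S d)
  ... | no nd = inj₂ (d , ℕ.≤-refl , h , nd)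
  ... | yes dd with degree-or-p∣ᴾ d S (mkDeg< λ { zero → subst (λ z → p∣ (coeff S z)) (sym (ℕ.+-identityʳ d)) dd
                                         ; (suc j) → subst (λ z → p∣ (coeff S z)) (sym (ℕ.+-suc d j)) (p∣coeff-beyond h j) })
  ... | inj₁ x = inj₁ x
  ... | inj₂ (d' , lt , h' , nd) = inj₂ (d' , ℕ.m≤n⇒m≤1+n lt , h' , nd)

  module DivisionBy (g : Poly) (d : ℕ) (Deg<-g : Deg< (suc d) g) (e : ℤ) (e-inverse : p∣ (e * coeff g d - + 1)) where

    divide : ∀ L P → Deg< L P → Σ Poly λ Q → Σ Poly λ S → (P ≈ ((Q *P g) +P S)) × Deg< d S
    divide zero    P Deg<-P = [] , P , ≈-refl , Deg<-mono ℕ.z≤n Deg<-P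
    divide (suc L) P Deg<-P with suc L ℕ.≤? d
    ... | yes L<d = [] , P , ≈-refl , Deg<-mono L<d Deg<-P
    ... | no  L≮d = rebuild (divide L (P -P T) Deg<-P-T)
      where
        m = L ℕ.∸ d
        t = coeff P L
        xᵐte = shift m (t * e ∷ [])
        T = shift m (scale (t * e) g)
        coeff-T : ∀ j → coeff T (L ℕ.+ j) ≡ t * e * coeff g (d ℕ.+ j)
        coeff-T j = trans (cong (coeff T) (trans (cong (ℕ._+ j) (sym (ℕ.m∸n+n≡m (ℕ.≮⇒≥ L≮d)))) (ℕ.+-assoc m d j)))
                          (trans (coeff-shift-+ m (scale (t * e) g) (d ℕ.+ j)) (coeff-scale (t * e) g (d ℕ.+ j)))
        leading-cancelled : ∀ j → p∣ (coeff P (L ℕ.+ j) - coeff T (L ℕ.+ j))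
        leading-cancelled zero    =
          subst p∣_ (trans (lemma t e (coeff g d))
                           (cong₂ (λ x y → coeff P x - y) (sym (ℕ.+-identityʳ L))
                                  (trans (cong (λ z → t * e * coeff g z) (sym (ℕ.+-identityʳ d))) (sym (coeff-T zero)))))
                    (∣m⇒∣-m (∣n⇒∣m*n t e-inverse))
          where lemma : ∀ t e g → - (t * (e * g - + 1)) ≡ t - t * e * g
                lemma = solve-∀
        leading-cancelled (suc j) =
          subst p∣_ (cong₂ (λ x y → coeff P x - y) (sym (ℕ.+-suc L j)) (sym (coeff-T (suc j))))
                    (∣m∣n⇒∣m-n (p∣coeff-beyond Deg<-P j)
                               (∣n⇒∣m*n (t * e) (subst (λ z → p∣ coeff g z) (sym (ℕ.+-suc d j)) (p∣coeff-beyond Deg<-g j))))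
        Deg<-P-T : Deg< L (P -P T)
        Deg<-P-T = mkDeg< λ j → subst p∣_ (sym (coeff--P P T (L ℕ.+ j))) (leading-cancelled j)
        T≐xᵐte*g : T ≐ (xᵐte *P g)
        T≐xᵐte*g = ≐-sym (≐-trans (shift-*P m (t * e ∷ []) g) (shift-cong m ([c]-*P (t * e) g)))
        rebuild : (Σ Poly λ Q → Σ Poly λ S → ((P -P T) ≈ ((Q *P g) +P S)) × Deg< d S) →
                  Σ Poly λ Q → Σ Poly λ S → (P ≈ ((Q *P g) +P S)) × Deg< d S
        rebuild (Q , S , P-T≈Qg+S , Deg<-S) = Q +P xᵐte , S , P≈ , Deg<-S
          where
            open ≈-Reasoning
            P≈ : P ≈ (((Q +P xᵐte) *P g) +P S)
            P≈ = begin
              P                                   ≈⟨ ≐⇒≈ (≐-sym (-P-+P P T)) ⟩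
              (P -P T) +P T                       ≈⟨ ≈-+P P-T≈Qg+S ≈-refl ⟩
              ((Q *P g) +P S) +P T                ≈⟨ ≐⇒≈ (≐-trans (+P-assoc (Q *P g) S T)
                                                      (≐-trans (+P-cong {Q *P g} ≐-refl (+P-comm S T)) (≐-sym (+P-assoc (Q *P g) T S)))) ⟩
              ((Q *P g) +P T) +P S                ≈⟨ ≐⇒≈ (+P-cong {g = S} (+P-cong {Q *P g} ≐-refl T≐xᵐte*g) ≐-refl) ⟩
              ((Q *P g) +P (xᵐte *P g)) +P S      ≈⟨ ≐⇒≈ (+P-cong {g = S} (≐-sym (*P-distribʳ Q xᵐte g)) ≐-refl) ⟩
              ((Q +P xᵐte) *P g) +P S             ∎

  ≈--P : ∀ {f f' g g'} → f ≈ f' → g ≈ g' → (f -P g) ≈ (f' -P g')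
  ≈--P e1 e2 = ≈-+P e1 (≈-scale (- + 1) e2)

  NonConst : Poly → Set
  NonConst g = Σ ℕ λ k → (1 ℕ.≤ k) × ¬ p∣ (coeff g k)

  p∣ᴾ-or-unitCoeff : ∀ Q → p∣ᴾ Q ⊎ Σ ℕ λ k → ¬ p∣ (coeff Q k)
  p∣ᴾ-or-unitCoeff [] = inj₁ (mkp∣ᴾ λ k → p∣0)
  p∣ᴾ-or-unitCoeff (a ∷ Q) with p∣? a
  ... | no na = inj₂ (zero , na)
  ... | yes da with p∣ᴾ-or-unitCoeff Q
  ... | inj₁ x = inj₁ (mkp∣ᴾ λ { zero → da ; (suc k) → p∣coeff x k })
  ... | inj₂ (k , nk) = inj₂ (suc k , nk)

  nonConst-or-≈const : ∀ Q → NonConst Q ⊎ (Q ≈ (coeff Q zero ∷ []))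
  nonConst-or-≈const [] = inj₂ (mk≈ λ { zero → p∣0 ; (suc k) → p∣0 })
  nonConst-or-≈const (a ∷ Q) with p∣ᴾ-or-unitCoeff Q
  ... | inj₁ x = inj₂ (mk≈ λ { zero → subst p∣_ (sym (ℤ.+-inverseʳ a)) p∣0 ; (suc k) → subst p∣_ (sym (ℤ.+-identityʳ _)) (p∣coeff x k) })
  ... | inj₂ (k , nk) = inj₁ (suc k , ℕ.s≤s ℕ.z≤n , nk)

  p∣ᴾ⇒≈[] : ∀ {Z} → p∣ᴾ Z → Z ≈ []
  p∣ᴾ⇒≈[] d = mk≈ λ k → subst p∣_ (sym (ℤ.+-identityʳ _)) (p∣coeff d k)

  Deg<-*P : ∀ f a b g → Deg< a f → Deg< b g → Deg< (a ℕ.+ b) (f *P g)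
  Deg<-*P [] a b g df dg = mkDeg< λ j → p∣0
  Deg<-*P (h ∷ f) zero b g df dg = mkDeg< λ j → p∣coeff (p∣ᴾ-*Pˡ (h ∷ f) g (mkp∣ᴾ λ k → p∣coeff-beyond df k)) (b ℕ.+ j)
  Deg<-*P (h ∷ f) (suc a) b g df dg = mkDeg< λ j →
    subst p∣_ (sym (coeff-*P h f g (suc a ℕ.+ b ℕ.+ j)))
      (∣m∣n⇒∣m+n (∣n⇒∣m*n h (subst (λ z → p∣ (coeff g z)) (ix j) (p∣coeff-beyond dg (suc a ℕ.+ j))))
           (p∣coeff-beyond (Deg<-*P f a b g (mkDeg< λ k → p∣coeff-beyond df k) dg) j))
    where
      ix : ∀ j → b ℕ.+ (suc a ℕ.+ j) ≡ suc a ℕ.+ b ℕ.+ j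
      ix j = trans (sym (ℕ.+-assoc b (suc a) j)) (cong (ℕ._+ j) (ℕ.+-comm b (suc a)))

  coeff-*P-top : ∀ g d h e → Deg< (suc d) g → Deg< (suc e) h →
            p∣ (coeff (g *P h) (d ℕ.+ e) - coeff g d * coeff h e)
  coeff-*P-top [] d h e dg dh = subst p∣_ (sym (lemma (coeff h e))) p∣0
    where lemma : ∀ x → + 0 - + 0 * x ≡ + 0
          lemma = solve-∀
  coeff-*P-top (a ∷ g) zero h e dg dh =
    subst p∣_ (sym (trans (cong (λ z → z - a * coeff h e) (coeff-*P a g h e)) (lemma (a * coeff h e) (coeff (+ 0 ∷ (g *P h)) e))))
        (shifted e)
    where
      lemma : ∀ x y → x + y - x ≡ y
      lemma = solve-∀
      shifted : ∀ e → p∣ (coeff (+ 0 ∷ (g *P h)) e)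
      shifted zero = p∣0
      shifted (suc e) = p∣coeff (p∣ᴾ-*Pˡ g h (mkp∣ᴾ λ k → p∣coeff-beyond dg k)) e
  coeff-*P-top (a ∷ g) (suc d) h e dg dh =
    subst p∣_ (sym (trans (cong (λ z → z - coeff g d * coeff h e) (coeff-*P a g h (suc d ℕ.+ e)))
                    (lemma (a * coeff h (suc d ℕ.+ e)) (coeff (g *P h) (d ℕ.+ e)) (coeff g d * coeff h e))))
        (∣m∣n⇒∣m+n (∣n⇒∣m*n a (subst (λ z → p∣ (coeff h z)) ix (p∣coeff-beyond dh d)))
             (coeff-*P-top g d h e (mkDeg< λ k → p∣coeff-beyond dg k) dh))
    where
      lemma : ∀ x y z → x + y - z ≡ x + (y - z)
      lemma = solve-∀
      ix : suc e ℕ.+ d ≡ suc d ℕ.+ e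
      ix = cong suc (ℕ.+-comm e d)

  -- Coefficient n + m of (xⁿ - c) w is w_m - c w_{n+m}, so w_m ≡ c w_{n+m} ≡ c² w_{2n+m} ≡ ⋯ ≡ 0.
  Deg<-xⁿ-c-*P⇒p∣ᴾ : ∀ n c w → 1 ℕ.≤ n → Deg< n (xⁿ-c n c *P w) → p∣ᴾ w
  Deg<-xⁿ-c-*P⇒p∣ᴾ n c w n≥1 d = mkp∣ᴾ λ m → vanishes (length w) m (ℕ.m≤n+m (length w) m)
    where
      vanishes : ∀ j m → length w ℕ.≤ m ℕ.+ j → p∣ (coeff w m)
      vanishes zero m le = subst p∣_ (sym (coeff-≥length w m (subst (length w ℕ.≤_) (ℕ.+-identityʳ m) le))) p∣0
      vanishes (suc j) m le = subst p∣_ (lemma (coeff w m) c (coeff w (n ℕ.+ m)))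
        (∣m∣n⇒∣m+n (subst p∣_ (coeff-xⁿ-c-*P-+ n c w m) (p∣coeff-beyond d m)) (∣n⇒∣m*n c (vanishes j (n ℕ.+ m) le')))
        where
          le' : length w ℕ.≤ n ℕ.+ m ℕ.+ j
          le' = ℕ.≤-trans le (subst (ℕ._≤ n ℕ.+ m ℕ.+ j) (sym (ℕ.+-suc m j))
                  (subst (λ z → suc (m ℕ.+ j) ℕ.≤ z) (sym (ℕ.+-assoc n m j)) (ℕ.+-monoˡ-≤ (m ℕ.+ j) n≥1)))
          lemma : ∀ a c b → a - c * b + c * b ≡ a
          lemma = solve-∀

  Deg<-xⁿ-c : ∀ n c → Deg< (suc n) (xⁿ-c n c)
  Deg<-xⁿ-c n c rewrite xⁿ-c≡shift n c = mkDeg< λ j → subst p∣_ (sym (trans (coeff-+P (shift n (+ 1 ∷ [])) (- c ∷ []) (suc n ℕ.+ j))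
      (trans (cong (λ z → coeff (shift n (+ 1 ∷ [])) z + coeff (- c ∷ []) (suc n ℕ.+ j)) (sym (ℕ.+-suc n j)))
      (trans (cong₂ _+_ (coeff-shift-+ n (+ 1 ∷ []) (suc j)) refl) refl)))) p∣0

  Deg<1⇒≈const : ∀ g → Deg< 1 g → g ≈ (coeff g zero ∷ [])
  Deg<1⇒≈const g dg = mk≈ λ { zero → subst p∣_ (sym (ℤ.+-inverseʳ (coeff g zero))) p∣0
                      ; (suc k) → subst p∣_ (sym (ℤ.+-identityʳ _)) (p∣coeff-beyond dg k) }

  p∣ᴾ-*Pʳ : ∀ Z Q → p∣ᴾ Z → p∣ᴾ (Q *P Z)
  p∣ᴾ-*Pʳ Z Q d = mkp∣ᴾ λ k → subst p∣_ (at≐ (*P-comm Z Q) k) (p∣coeff (p∣ᴾ-*Pˡ Z Q d) k)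

  -- For irreducible f = xⁿ - c, the polynomials g with g v ∈ (f) form an ideal containing f; the remainder
  -- of f by such a g lies in it again, so descending on the degree ends in a unit (forcing v ≡ 0) or in
  -- a proper factorisation of f.
  module NoZeroDivisors (n : ℕ) (n≥1 : 1 ℕ.≤ n) (c : ℤ)
           (irreducible : ∀ g h → (g *P h) ≈ xⁿ-c n c → ¬ (NonConst g × NonConst h))
           (v : Poly) (Deg<-v : Deg< n v) (k : ℕ) (p∤vₖ : ¬ p∣ coeff v k) where

    f : Poly
    f = xⁿ-c n c

    Annihilates : Poly → Set
    Annihilates g = Σ Poly λ w → (g *P v) ≈ (f *P w)

    unit-cannot-annihilate : ∀ g → Deg< 1 g → ¬ p∣ coeff g 0 → ¬ Annihilates g
    unit-cannot-annihilate g Deg<-g p∤g₀ (w , gv≈fw) = p∤vₖ (p∣*-cancelˡ (coeff v k) p∤g₀ p∣g₀vₖ)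
      where
        g₀ = coeff g zero
        g₀v≈fw : scale g₀ v ≈ (f *P w)
        g₀v≈fw = ≈-trans (≐⇒≈ (≐-sym ([c]-*P g₀ v))) (≈-trans (≈-*Pˡ v (≈-sym (Deg<1⇒≈const g Deg<-g))) gv≈fw)
        Deg<-g₀v : Deg< n (scale g₀ v)
        Deg<-g₀v = mkDeg< λ j → subst p∣_ (sym (coeff-scale g₀ v (n ℕ.+ j))) (∣n⇒∣m*n g₀ (p∣coeff-beyond Deg<-v j))
        p∣fw : p∣ᴾ (f *P w)
        p∣fw = p∣ᴾ-*Pʳ w f (Deg<-xⁿ-c-*P⇒p∣ᴾ n c w n≥1 (Deg<-≈ g₀v≈fw Deg<-g₀v))
        p∣g₀vₖ : p∣ (g₀ * coeff v k)
        p∣g₀vₖ = subst p∣_ (trans (lemma (coeff (scale g₀ v) k) (coeff (f *P w) k)) (coeff-scale g₀ v k))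
                           (∣m∣n⇒∣m+n (at≈ g₀v≈fw k) (p∣coeff p∣fw k))
          where lemma : ∀ a b → a - b + b ≡ a
                lemma = solve-∀

    remainder-annihilates : ∀ g Q S → f ≈ ((Q *P g) +P S) → Annihilates g → Annihilates S
    remainder-annihilates g Q S f≈Qg+S (w , gv≈fw) = v -P (Q *P w) , Sv≈f[v-Qw]
      where
        S≈f-Qg : S ≈ (f -P (Q *P g))
        S≈f-Qg = ≈-trans (≐⇒≈ (≐-sym (+P--P (Q *P g) S))) (≈--P (≈-sym f≈Qg+S) ≈-refl)
        Qgv≈fQw : ((Q *P g) *P v) ≈ (f *P (Q *P w))
        Qgv≈fQw = ≈-trans (≐⇒≈ (*P-assoc Q g v)) (≈-trans (≈-*Pʳ Q gv≈fw)
                    (≐⇒≈ (≐-trans (≐-sym (*P-assoc Q f w)) (≐-trans (*P-congˡ w (*P-comm Q f)) (*P-assoc f Q w)))))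
        Sv≈f[v-Qw] : (S *P v) ≈ (f *P (v -P (Q *P w)))
        Sv≈f[v-Qw] = ≈-trans (≈-*Pˡ v S≈f-Qg) (≈-trans (≐⇒≈ (*P--Pˡ f (Q *P g) v))
                       (≈-trans (≈--P {f *P v} ≈-refl Qgv≈fQw) (≐⇒≈ (≐-sym (*P--Pʳ f v (Q *P w))))))

    -- If f ≈ Q g with Q constant, comparing coefficients of xⁿ gives 1 ≡ Q₀ gₙ ≡ 0 since deg g < n.
    no-proper-divisor : ∀ g d → 1 ℕ.≤ d → d ℕ.< n → Deg< (suc d) g → ¬ p∣ coeff g d → ∀ Q → ¬ f ≈ (Q *P g)
    no-proper-divisor g d d≥1 d<n Deg<-g p∤g_d Q f≈Qg = irreducible Q g (≈-sym f≈Qg) (Q-nonConst , (d , d≥1 , p∤g_d))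
      where
        Q-nonConst : NonConst Q
        Q-nonConst with nonConst-or-≈const Q
        ... | inj₁ Q-nonConst = Q-nonConst
        ... | inj₂ Q≈Q₀ = ⊥-elim (p∤1 (subst p∣_ coeffₙ (∣m∣n⇒∣m+n (at≈ f≈Q₀g n) (∣n⇒∣m*n (coeff Q zero) p∣gₙ))))
          where
            f≈Q₀g : f ≈ scale (coeff Q zero) g
            f≈Q₀g = ≈-trans f≈Qg (≈-trans (≈-*Pˡ g Q≈Q₀) (≐⇒≈ ([c]-*P (coeff Q zero) g)))
            p∣gₙ : p∣ coeff g n
            p∣gₙ = Deg<-at n d<n Deg<-g
            coeffₙ : coeff f n - coeff (scale (coeff Q zero) g) n + coeff Q zero * coeff g n ≡ + 1
            coeffₙ = trans (cong₂ (λ x y → x - y + coeff Q zero * coeff g n) (coeff-xⁿ-c-n n c n≥1) (coeff-scale (coeff Q zero) g n))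
                           (lemma (coeff Q zero * coeff g n))
              where lemma : ∀ a → + 1 - a + a ≡ + 1
                    lemma = solve-∀

    descent : ∀ fuel d g → d ℕ.< fuel → d ℕ.< n → Deg< (suc d) g → ¬ p∣ coeff g d → ¬ Annihilates g
    descent (suc fuel) zero    g _ _ Deg<-g p∤g₀ = unit-cannot-annihilate g Deg<-g p∤g₀
    descent (suc fuel) (suc d) g d<fuel d<n Deg<-g p∤g_d annihilates
      with inverse (coeff g (suc d)) p∤g_d
    ... | e , e-inverse with DivisionBy.divide g (suc d) Deg<-g e e-inverse (suc n) f (Deg<-xⁿ-c n c)
    ... | Q , S , f≈Qg+S , Deg<-S with degree-or-p∣ᴾ (suc d) S Deg<-S
    ...   | inj₁ p∣S = no-proper-divisor g (suc d) (ℕ.s≤s ℕ.z≤n) d<n Deg<-g p∤g_d Q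
              (≈-trans f≈Qg+S (≈-trans (≈-+P {Q *P g} ≈-refl (p∣ᴾ⇒≈[] p∣S)) (≐⇒≈ (+P-identityʳ (Q *P g)))))
    ...   | inj₂ (d′ , d′<d , Deg<-S′ , p∤S_d′) =
      descent fuel d′ S (ℕ.<-≤-trans d′<d (ℕ.≤-pred d<fuel)) (ℕ.<-trans d′<d d<n) Deg<-S′ p∤S_d′
              (remainder-annihilates g Q S f≈Qg+S annihilates)

    no-zero-divisors : ∀ α w → Deg< n α → ¬ p∣ᴾ α → ¬ (α *P v) ≈ (f *P w)
    no-zero-divisors α w Deg<-α p∤α αv≈fw with degree-or-p∣ᴾ n α Deg<-α
    ... | inj₁ p∣α = p∤α p∣α
    ... | inj₂ (d , d<n , Deg<-α′ , p∤α_d) = descent (suc d) d α ℕ.≤-refl d<n Deg<-α′ p∤α_d (w , αv≈fw)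

  NonConst⇒NonConstMod : ∀ {g} → NonConst g → NonConstMod p g
  NonConst⇒NonConstMod (k , k≥1 , p∤gₖ) = k , k≥1 , λ p∣gₖ → p∤gₖ (∣ᵤ⇒∣ p∣gₖ)

  NonConstMod⇒NonConst : ∀ {g} → NonConstMod p g → NonConst g
  NonConstMod⇒NonConst (k , k≥1 , p∤gₖ) = k , k≥1 , λ p∣gₖ → p∤gₖ (∣⇒∣ᵤ p∣gₖ)

  IrreducibleMod⇒noFactorisation : ∀ {f} → IrreducibleMod p f →
    ∀ g h → (g *P h) ≈ f → ¬ (NonConst g × NonConst h)
  IrreducibleMod⇒noFactorisation (_ , irreducible) g h gh≈f (g-nonConst , h-nonConst) =
    irreducible g h (λ k → ∣⇒∣ᵤ (at≈ gh≈f k)) (NonConst⇒NonConstMod {g} g-nonConst , NonConst⇒NonConstMod {h} h-nonConst)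

toPoly : ∀ n → (Fin n → ℤ) → Poly
toPoly zero x = []
toPoly (suc n) x = x fz ∷ toPoly n (λ j → x (fs j))

length-toPoly : ∀ n x → length (toPoly n x) ≡ n
length-toPoly zero x = refl
length-toPoly (suc n) x = cong suc (length-toPoly n (λ j → x (fs j)))

coeff-toPoly-< : ∀ n x k (lt : k ℕ.< n) → coeff (toPoly n x) k ≡ x (fromℕ< lt)
coeff-toPoly-< (suc n) x zero lt = refl
coeff-toPoly-< (suc n) x (suc k) lt = coeff-toPoly-< n (λ j → x (fs j)) k (ℕ.s<s⁻¹ lt)

coeff-toPoly-toℕ : ∀ n x (j : Fin n) → coeff (toPoly n x) (toℕ j) ≡ x j
coeff-toPoly-toℕ (suc n) x fz = refl
coeff-toPoly-toℕ (suc n) x (fs j) = coeff-toPoly-toℕ n (λ j → x (fs j)) j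

coeff-toPoly : ∀ n x k → coeff (toPoly n x) k ≡ at x k
coeff-toPoly n x k with k ℕ.<? n
... | yes lt = coeff-toPoly-< n x k lt
... | no nlt = coeff-≥length (toPoly n x) k (subst (ℕ._≤ k) (sym (length-toPoly n x)) (ℕ.≮⇒≥ nlt))

coeff-toPoly-*P : ∀ n v g k → coeff (toPoly n v *P g) k ≡ sumFin n (λ j → v j * coeff (shift (toℕ j) g) k)
coeff-toPoly-*P zero v g k = refl
coeff-toPoly-*P (suc n) v g zero =
  trans (coeff-*P (v fz) (toPoly n (λ j → v (fs j))) g zero)
        (cong (λ z → v fz * coeff g zero + z) (sym (sumFin-zero n (λ j → v (fs j) * + 0) (λ j → ℤ.*-zeroʳ (v (fs j))))))
coeff-toPoly-*P (suc n) v g (suc k) =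
  trans (coeff-*P (v fz) (toPoly n (λ j → v (fs j))) g (suc k))
        (cong (λ z → v fz * coeff g (suc k) + z) (coeff-toPoly-*P n (λ j → v (fs j)) g k))

M-*-entry : ∀ r n x (v : Fin n → ℤ) (i j : Fin n) →
  M r n x i j * v j ≡ v j * coeff (shift (toℕ j) (toPoly n x)) (toℕ i)
                      + r * (v j * coeff (shift (toℕ j) (toPoly n x)) (n ℕ.+ toℕ i))
M-*-entry r n x v i j with toℕ j ℕ.≤? toℕ i
... | yes le = trans (lemma (at x (toℕ i ∸ toℕ j)) (v j) r)
    (cong₂ (λ a b → v j * a + r * (v j * b))
      (sym (trans (coeff-shift-≥ (toℕ j) (toPoly n x) (toℕ i) le) (coeff-toPoly n x (toℕ i ∸ toℕ j))))
      (sym (trans (coeff-shift-≥ (toℕ j) (toPoly n x) (n ℕ.+ toℕ i) (ℕ.m≤n⇒m≤o+n n le))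
                  (coeff-≥length (toPoly n x) (n ℕ.+ toℕ i ∸ toℕ j)
                     (subst₂ ℕ._≤_ (sym (length-toPoly n x)) (sym (ℕ.+-∸-assoc n le)) (ℕ.m≤m+n n (toℕ i ∸ toℕ j)))))))
  where lemma : ∀ a v r → a * v ≡ v * a + r * (v * + 0)
        lemma = solve-∀
... | no nle = trans (lemma (at x (n ℕ.+ toℕ i ∸ toℕ j)) (v j) r)
    (cong₂ (λ a b → v j * a + r * (v j * b))
      (sym (coeff-shift-< (toℕ j) (toPoly n x) (toℕ i) (ℕ.≰⇒> nle)))
      (sym (trans (coeff-shift-≥ (toℕ j) (toPoly n x) (n ℕ.+ toℕ i) (ℕ.m≤n⇒m≤n+o (toℕ i) (ℕ.<⇒≤ (toℕ<n j))))
                  (coeff-toPoly n x (n ℕ.+ toℕ i ∸ toℕ j)))))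
  where lemma : ∀ a v r → r * a * v ≡ v * + 0 + r * (v * a)
        lemma = solve-∀

M-*-row : ∀ r n x v (i : Fin n) →
  sumFin n (λ j → M r n x i j * v j) ≡
  coeff (toPoly n v *P toPoly n x) (toℕ i) + r * coeff (toPoly n v *P toPoly n x) (n ℕ.+ toℕ i)
M-*-row r n x v i =
  trans (sumFin-cong n (M-*-entry r n x v i))
  (trans (sumFin-+ n (λ j → v j * coeff (shift (toℕ j) α) (toℕ i)) (λ j → r * (v j * coeff (shift (toℕ j) α) (n ℕ.+ toℕ i))))
  (cong₂ _+_ (sym (coeff-toPoly-*P n v α (toℕ i)))
             (trans (sumFin-*ˡ n r (λ j → v j * coeff (shift (toℕ j) α) (n ℕ.+ toℕ i)))
                    (cong (r *_) (sym (coeff-toPoly-*P n v α (n ℕ.+ toℕ i)))))))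
  where α = toPoly n x

coeff-drop : ∀ n L k → coeff (drop n L) k ≡ coeff L (n ℕ.+ k)
coeff-drop zero L k = refl
coeff-drop (suc n) [] k = refl
coeff-drop (suc n) (a ∷ L) k = coeff-drop n L k

module NormModulo (p : ℕ) (p-prime : Prime p) where

  open PolynomialsModulo p p-prime

  p∣at : ∀ {n} (x : Fin n → ℤ) → (∀ j → p∣ x j) → ∀ k → p∣ at x k
  p∣at {n} x p∣x k with k ℕ.<? n
  ... | yes _ = p∣x _
  ... | no  _ = p∣0

  p∣M : ∀ r n x → (∀ j → p∣ x j) → ∀ i j → p∣ M r n x i j
  p∣M r n x p∣x i j with toℕ j ℕ.≤? toℕ i
  ... | yes _ = p∣at x p∣x _
  ... | no  _ = ∣n⇒∣m*n r (p∣at x p∣x _)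

  Deg<-toPoly : ∀ n (x : Fin n → ℤ) → Deg< n (toPoly n x)
  Deg<-toPoly n x = subst (λ l → Deg< l (toPoly n x)) (length-toPoly n x) (Deg<-len (toPoly n x))

  pⁿ∤p : ∀ n → 2 ℕ.≤ n → ¬ ((+ p) ^ n) S.∣ + p
  pⁿ∤p (suc zero)    (ℕ.s≤s ())
  pⁿ∤p (suc (suc k)) _ pⁿ∣p = p∤1 (S.∣-trans (∣m⇒∣m*n ((+ p) ^ k) ∣-refl) pⁿ⁻¹∣1)
    where
      pⁿ⁻¹∣1 : (+ p) ^ suc k S.∣ + 1
      pⁿ⁻¹∣1 = S.*-cancelˡ-∣ (+ p) {{prime⇒nonZero p-prime}} (subst ((+ p) ^ suc (suc k) S.∣_) (sym (ℤ.*-identityʳ (+ p))) pⁿ∣p)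

  p∣x⇒D≢p : ∀ r n → 2 ℕ.≤ n → (x : Fin n → ℤ) → (∀ j → p∣ x j) → D r n x ≢ + p
  p∣x⇒D≢p r n n≥2 x p∣x D≡p = pⁿ∤p n n≥2 (subst ((+ p) ^ n S.∣_) D≡p (p∣entries⇒pⁿ∣det n (M r n x) (p∣M r n x p∣x)))

  -- Row i of M v is coefficient i of v α reduced modulo xⁿ - r, and r ≡ r₀; so M v ≡ 0 says
  -- that v α agrees with (xⁿ - r₀) w, where w collects the coefficients of v α from degree n on.
  M-kernel⇒multiple : ∀ r r₀ n (x v : Fin n → ℤ) → p∣ (r - r₀) →
    (∀ i → p∣ sumFin n (λ j → M r n x i j * v j)) →
    (toPoly n x *P toPoly n v) ≈ (xⁿ-c n r₀ *P drop n (toPoly n v *P toPoly n x))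
  M-kernel⇒multiple r r₀ n x v p∣r-r₀ Mv≡0 = ≈-trans (≐⇒≈ (*P-comm (toPoly n x) (toPoly n v))) (mk≈ coeff≡)
    where
      vα = toPoly n v *P toPoly n x
      w = drop n vα
      f = xⁿ-c n r₀
      Deg<-vα : Deg< (n ℕ.+ n) vα
      Deg<-vα = Deg<-*P (toPoly n v) n n (toPoly n x) (Deg<-toPoly n v) (Deg<-toPoly n x)
      low : ∀ k → k ℕ.< n → p∣ (coeff vα k - coeff (f *P w) k)
      low k k<n = subst p∣_ eq (∣m∣n⇒∣m-n row (∣m⇒∣m*n (coeff vα (n ℕ.+ k)) p∣r-r₀))
        where
          row : p∣ (coeff vα k + r * coeff vα (n ℕ.+ k))
          row = subst (λ z → p∣ (coeff vα z + r * coeff vα (n ℕ.+ z))) (toℕ-fromℕ< k<n)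
                      (subst p∣_ (M-*-row r n x v (fromℕ< k<n)) (Mv≡0 (fromℕ< k<n)))
          eq : coeff vα k + r * coeff vα (n ℕ.+ k) - (r - r₀) * coeff vα (n ℕ.+ k) ≡ coeff vα k - coeff (f *P w) k
          eq = trans (lemma (coeff vα k) r r₀ (coeff vα (n ℕ.+ k)))
                     (cong (_-_ (coeff vα k)) (sym (trans (coeff-xⁿ-c-*P-< n r₀ w k k<n) (cong (λ z → - r₀ * z) (coeff-drop n vα k)))))
            where lemma : ∀ a r s b → a + r * b - (r - s) * b ≡ a - (- s * b)
                  lemma = solve-∀
      high : ∀ m → p∣ (coeff vα (n ℕ.+ m) - coeff (f *P w) (n ℕ.+ m))
      high m = subst p∣_ (sym eq) (∣n⇒∣m*n r₀ (subst (λ z → p∣ coeff vα z) (ℕ.+-assoc n n m) (p∣coeff-beyond Deg<-vα m)))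
        where
          eq : coeff vα (n ℕ.+ m) - coeff (f *P w) (n ℕ.+ m) ≡ r₀ * coeff vα (n ℕ.+ (n ℕ.+ m))
          eq = trans (cong (_-_ (coeff vα (n ℕ.+ m)))
                           (trans (coeff-xⁿ-c-*P-+ n r₀ w m)
                                  (cong₂ (λ a b → a - r₀ * b) (coeff-drop n vα m) (coeff-drop n vα (n ℕ.+ m)))))
                     (lemma (coeff vα (n ℕ.+ m)) r₀ (coeff vα (n ℕ.+ (n ℕ.+ m))))
            where lemma : ∀ a s b → a - (a - s * b) ≡ s * b
                  lemma = solve-∀
      coeff≡ : ∀ k → p∣ (coeff vα k - coeff (f *P w) k)
      coeff≡ k with k ℕ.<? n
      ... | yes k<n = low k k<n
      ... | no  k≮n = subst (λ z → p∣ (coeff vα z - coeff (f *P w) z)) (ℕ.m+[n∸m]≡n (ℕ.≮⇒≥ k≮n)) (high (k ∸ n))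

  D≢p : ∀ r r₀ → (+ p) ∣ (r - r₀) → ∀ n → 2 ℕ.≤ n → IrreducibleMod p (xⁿ-c n r₀) → (x : Fin n → ℤ) → D r n x ≢ + p
  D≢p r r₀ p∣ᵤr-r₀ n n≥2 irreducible x D≡p with any? (λ j → ¬? (p∣? (x j)))
  ... | no all-p∣ = p∣x⇒D≢p r n n≥2 x p∣x D≡p
    where p∣x : ∀ j → p∣ x j
          p∣x j with p∣? (x j)
          ... | yes p∣xⱼ = p∣xⱼ
          ... | no  p∤xⱼ = ⊥-elim (all-p∣ (j , p∤xⱼ))
  ... | yes (j , p∤xⱼ) with p∣det⇒kernelVector n (M r n x) (subst p∣_ (sym D≡p) ∣-refl)
  ...   | v , (k , p∤vₖ) , Mv≡0 =
    NoZeroDivisors.no-zero-divisors n (ℕ.≤-trans (ℕ.s≤s ℕ.z≤n) n≥2) r₀ (IrreducibleMod⇒noFactorisation irreducible)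
      (toPoly n v) (Deg<-toPoly n v) (toℕ k) (p∤vₖ ∘ subst p∣_ (coeff-toPoly-toℕ n v k))
      (toPoly n x) _ (Deg<-toPoly n x) (λ p∣x → p∤xⱼ (subst p∣_ (coeff-toPoly-toℕ n x j) (p∣coeff p∣x (toℕ j))))
      (M-kernel⇒multiple r r₀ n x v (∣ᵤ⇒∣ p∣ᵤr-r₀) Mv≡0)

sumℕ : ℕ → (ℕ → ℤ) → ℤ
sumℕ zero h = + 0
sumℕ (suc n) h = h 0 + sumℕ n (λ t → h (suc t))

sumℕ-cong : ∀ n {h h'} → (∀ t → h t ≡ h' t) → sumℕ n h ≡ sumℕ n h'
sumℕ-cong zero e = refl
sumℕ-cong (suc n) e = cong₂ _+_ (e 0) (sumℕ-cong n (λ t → e (suc t)))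

sumFin-toℕ≡sumℕ : ∀ n (h : ℕ → ℤ) → sumFin n (λ j → h (toℕ j)) ≡ sumℕ n h
sumFin-toℕ≡sumℕ zero h = refl
sumFin-toℕ≡sumℕ (suc n) h = cong (λ z → h 0 + z) (sumFin-toℕ≡sumℕ n (λ t → h (suc t)))

sumℕ-snoc : ∀ n (h : ℕ → ℤ) → sumℕ (suc n) h ≡ sumℕ n h + h n
sumℕ-snoc zero h = ℤ.+-comm (h 0) (+ 0)
sumℕ-snoc (suc n) h = trans (cong (λ z → h 0 + z) (sumℕ-snoc n (λ t → h (suc t)))) (sym (ℤ.+-assoc (h 0) _ _))

sumℕ-reverse : ∀ m (h : ℕ → ℤ) → sumℕ (suc m) (λ t → h (m ∸ t)) ≡ sumℕ (suc m) h
sumℕ-reverse zero h = refl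
sumℕ-reverse (suc m) h =
  trans (cong (λ z → h (suc m) + z) (sumℕ-reverse m h))
        (trans (ℤ.+-comm (h (suc m)) (sumℕ (suc m) h)) (sym (sumℕ-snoc (suc m) h)))

punchIn-fromℕ≡inject₁ : ∀ {m} (k : Fin m) → punchIn (fromℕ m) k ≡ inject₁ k
punchIn-fromℕ≡inject₁ fz = refl
punchIn-fromℕ≡inject₁ (fs k) = cong fs (punchIn-fromℕ≡inject₁ k)

-- window k is the k-th power of the companion matrix of x^{m+1} + a_m x^m + ⋯ + a_0, with its rows
-- in reverse order: row i is seq (k + m - i), where seq satisfies the linear recurrence with these
-- coefficients (seq (t + m + 1) = - Σ_s a_s seq (t + s)) and starts with the unit vectors.
module Recurrence (m : ℕ) (a : ℕ → ℤ) where

  window : ℕ → Matrix (suc m)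
  window zero            = identity
  window (suc k) fz l     = - sumFin (suc m) (λ j → a (m ∸ toℕ j) * window k j l)
  window (suc k) (fs i) l = window k (inject₁ i) l

  seq : ℕ → Fin (suc m) → ℤ
  seq t = window t (fromℕ m)

  window-row : ∀ j k (i : Fin (suc m)) → toℕ i ℕ.+ j ≡ m → ∀ l → window k i l ≡ seq (k ℕ.+ j) l
  window-row zero    k i i+0≡m l = cong₂ (λ t r → window t r l) (sym (ℕ.+-identityʳ k))
    (toℕ-injective (trans (trans (sym (ℕ.+-identityʳ (toℕ i))) i+0≡m) (sym (toℕ-fromℕ m))))
  window-row (suc j) k i i+j≡m l = begin
    window k i l                         ≡⟨ cong (λ r → window k r l) (sym (inject₁-lower₁ i m≢i)) ⟩
    window (suc k) (fs (lower₁ i m≢i)) l ≡⟨ window-row j (suc k) (fs (lower₁ i m≢i)) i+1+j≡m l ⟩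
    seq (suc k ℕ.+ j) l                  ≡⟨ cong (λ t → seq t l) (sym (ℕ.+-suc k j)) ⟩
    seq (k ℕ.+ suc j) l                  ∎
    where
      open ≡-Reasoning
      m≢i : m ≢ toℕ i
      m≢i m≡i = ℕ.<-irrefl (sym (trans i+j≡m m≡i)) (ℕ.m<m+n (toℕ i) (ℕ.s≤s ℕ.z≤n))
      i+1+j≡m : toℕ (fs (lower₁ i m≢i)) ℕ.+ j ≡ m
      i+1+j≡m = trans (cong (λ z → suc z ℕ.+ j) (toℕ-lower₁ i m≢i)) (trans (sym (ℕ.+-suc (toℕ i) j)) i+j≡m)

  detCompanion : ℤ
  detCompanion = - a 0 * sign m

  -- Row 0 of window (k + 1) is a combination of the rows of window k; all but the last term repeat a
  -- row of window (k + 1), and the last is window k with its rows rotated.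
  det-window : ∀ k → det (suc m) (window k) ≡ detCompanion ^ k
  det-window zero    = det-identity (suc m)
  det-window (suc k) = begin
    det (suc m) (window (suc k))
      ≡⟨ det-row₀-combination m (window (suc k)) (suc m) (λ j → - a (m ∸ toℕ j)) (window k) row₀ ⟩
    sumFin (suc m) term
      ≡⟨ sumFin-punchIn m (fromℕ m) term ⟩
    term (fromℕ m) + sumFin m (λ j → term (punchIn (fromℕ m) j))
      ≡⟨ cong₂ _+_ last (sumFin-zero m (λ j → term (punchIn (fromℕ m) j)) others) ⟩
    - a 0 * (sign m * det (suc m) (window k)) + + 0
      ≡⟨ ℤ.+-identityʳ _ ⟩
    - a 0 * (sign m * det (suc m) (window k))
      ≡⟨ cong (λ z → - a 0 * (sign m * z)) (det-window k) ⟩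
    - a 0 * (sign m * detCompanion ^ k)
      ≡⟨ sym (ℤ.*-assoc (- a 0) (sign m) (detCompanion ^ k)) ⟩
    detCompanion ^ suc k ∎
    where
      open ≡-Reasoning
      term : Fin (suc m) → ℤ
      term j = - a (m ∸ toℕ j) * det (suc m) (replaceRow fz (window k j) (window (suc k)))
      row₀ : ∀ l → window (suc k) fz l ≡ sumFin (suc m) (λ j → - a (m ∸ toℕ j) * window k j l)
      row₀ l = trans (sym (sumFin-neg (suc m) (λ j → a (m ∸ toℕ j) * window k j l)))
                     (sumFin-cong (suc m) (λ j → ℤ.neg-distribˡ-* (a (m ∸ toℕ j)) (window k j l)))
      last : term (fromℕ m) ≡ - a 0 * (sign m * det (suc m) (window k))
      last = cong₂ (λ t d → - a t * d) (trans (cong (m ∸_) (toℕ-fromℕ m)) (ℕ.n∸n≡0 m))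
                   (trans (det-cong (suc m) rotated) (det-rotateRows m (window k)))
        where rotated : ∀ i l → replaceRow fz (window k (fromℕ m)) (window (suc k)) i l ≡ rotateRows (window k) i l
              rotated fz     l = refl
              rotated (fs i) l = refl
      others : ∀ j → term (punchIn (fromℕ m) j) ≡ + 0
      others j = trans (cong (- a (m ∸ toℕ (punchIn (fromℕ m) j)) *_)
                             (det-repeatedRow₀ m (replaceRow fz (window k (punchIn (fromℕ m) j)) (window (suc k))) j
                                               (λ l → cong (λ r → window k r l) (punchIn-fromℕ≡inject₁ j))))
                       (ℤ.*-zeroʳ (- a (m ∸ toℕ (punchIn (fromℕ m) j))))

fromSeq : ℕ → (ℕ → ℤ) → Poly
fromSeq zero    a = []
fromSeq (suc n) a = a 0 ∷ fromSeq n (λ t → a (suc t))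

coeff-fromSeq++-< : ∀ n a X t → t ℕ.< n → coeff (fromSeq n a ++ X) t ≡ a t
coeff-fromSeq++-< (suc n) a X zero    _           = refl
coeff-fromSeq++-< (suc n) a X (suc t) (ℕ.s≤s t<n) = coeff-fromSeq++-< n (λ t → a (suc t)) X t t<n

coeff-fromSeq++-+ : ∀ n a X t → coeff (fromSeq n a ++ X) (n ℕ.+ t) ≡ coeff X t
coeff-fromSeq++-+ zero    a X t = refl
coeff-fromSeq++-+ (suc n) a X t = coeff-fromSeq++-+ n (λ t → a (suc t)) X t

^-distrib-* : ∀ a b k → (a * b) ^ k ≡ a ^ k * b ^ k
^-distrib-* a b zero    = refl
^-distrib-* a b (suc k) = trans (cong ((a * b) *_) (^-distrib-* a b k)) (lemma a b (a ^ k) (b ^ k))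
  where lemma : ∀ a b x y → a * b * (x * y) ≡ a * x * (b * y)
        lemma = solve-∀

^-swap : ∀ a m n → (a ^ m) ^ n ≡ (a ^ n) ^ m
^-swap a m n = trans (ℤ.^-*-assoc a m n) (trans (cong (a ^_) (ℕ.*-comm m n)) (sym (ℤ.^-*-assoc a n m)))

module CompanionModulo (p : ℕ) (p-prime : Prime p) where

  open PolynomialsModulo p p-prime

  module Annihilator (m : ℕ) (a : ℕ → ℤ) where
    open Recurrence m a

    charPoly : Poly
    charPoly = fromSeq (suc m) a ++ (+ 1 ∷ [])

    -- act s P l is P(shift) applied to seq at time s (column l); the recurrence says charPoly kills seq.
    act : ℕ → Poly → Fin (suc m) → ℤ
    act s [] l = + 0
    act s (c ∷ P) l = c * seq s l + act (suc s) P l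

    act-+P : ∀ s P Q l → act s (P +P Q) l ≡ act s P l + act s Q l
    act-+P s [] Q l = sym (ℤ.+-identityˡ _)
    act-+P s (c ∷ P) [] l = sym (ℤ.+-identityʳ _)
    act-+P s (c ∷ P) (e ∷ Q) l = trans (cong (λ z → (c + e) * seq s l + z) (act-+P (suc s) P Q l))
                                     (lemma c e (seq s l) (act (suc s) P l) (act (suc s) Q l))
      where lemma : ∀ c e x y z → (c + e) * x + (y + z) ≡ (c * x + y) + (e * x + z)
            lemma = solve-∀

    act-scale : ∀ s c P l → act s (scale c P) l ≡ c * act s P l
    act-scale s c [] l = sym (ℤ.*-zeroʳ c)
    act-scale s c (e ∷ P) l = trans (cong (λ z → c * e * seq s l + z) (act-scale (suc s) c P l))
                                  (lemma c e (seq s l) (act (suc s) P l))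
      where lemma : ∀ c e x y → c * e * x + c * y ≡ c * (e * x + y)
            lemma = solve-∀

    act-p∣ᴾ : ∀ s Z l → p∣ᴾ Z → p∣ (act s Z l)
    act-p∣ᴾ s [] l d = p∣0
    act-p∣ᴾ s (c ∷ Z) l d = ∣m∣n⇒∣m+n (∣m⇒∣m*n (seq s l) (p∣coeff d zero)) (act-p∣ᴾ (suc s) Z l (mkp∣ᴾ λ k → p∣coeff d (suc k)))

    act-≈ : ∀ s {P P'} l → P ≈ P' → p∣ (act s P l - act s P' l)
    act-≈ s {P} {P'} l e = subst p∣_ eq (act-p∣ᴾ s (P -P P') l (mkp∣ᴾ λ k → subst p∣_ (sym (coeff--P P P' k)) (at≈ e k)))
      where
        eq : act s (P -P P') l ≡ act s P l - act s P' l
        eq = trans (act-+P s P (scale (- + 1) P') l) (trans (cong (λ z → act s P l + z) (act-scale s (- + 1) P' l)) (lemma (act s P l) (act s P' l)))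
          where lemma : ∀ a b → a + (- + 1) * b ≡ a - b
                lemma = solve-∀

    act-shift : ∀ s n P l → act s (shift n P) l ≡ act (s ℕ.+ n) P l
    act-shift s zero P l = cong (λ z → act z P l) (sym (ℕ.+-identityʳ s))
    act-shift s (suc n) P l = trans (cong (_+ act (suc s) (shift n P) l) (ℤ.*-zeroˡ (seq s l)))
                         (trans (ℤ.+-identityˡ _) (trans (act-shift (suc s) n P l) (cong (λ z → act z P l) (sym (ℕ.+-suc s n)))))

    act-fromSeq++ : ∀ n (b : ℕ → ℤ) s X l → act s (fromSeq n b ++ X) l ≡ sumℕ n (λ t → b t * seq (s ℕ.+ t) l) + act (s ℕ.+ n) X l
    act-fromSeq++ zero b s X l = trans (cong (λ z → act z X l) (sym (ℕ.+-identityʳ s))) (sym (ℤ.+-identityˡ _))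
    act-fromSeq++ (suc n) b s X l =
      trans (cong (λ z → b 0 * seq s l + z) (act-fromSeq++ n (λ t → b (suc t)) (suc s) X l))
      (trans (sym (ℤ.+-assoc (b 0 * seq s l) _ _))
      (cong₂ _+_ (cong₂ _+_ (cong (λ z → b 0 * seq z l) (sym (ℕ.+-identityʳ s)))
                            (sumℕ-cong n (λ t → cong (λ z → b (suc t) * seq z l) (sym (ℕ.+-suc s t)))))
                 (cong (λ z → act z X l) (sym (ℕ.+-suc s n)))))

    act-charPoly : ∀ s l → act s charPoly l ≡ + 0
    act-charPoly s l = trans (act-fromSeq++ (suc m) a s (+ 1 ∷ []) l)
              (trans (cong (λ z → S + (+ 1 * z + + 0)) vd) (lemma S))
      where
        h : ℕ → ℤ
        h t = a t * seq (s ℕ.+ t) l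
        S = sumℕ (suc m) h
        vd : seq (s ℕ.+ suc m) l ≡ - S
        vd = trans (cong (λ z → seq z l) (ℕ.+-suc s m))
             (trans (sym (window-row m (suc s) fz refl l))
             (cong -_ (trans (sumFin-cong (suc m) (λ j → cong (a (m ∸ toℕ j) *_)
                               (window-row (m ∸ toℕ j) s j (ℕ.m+[n∸m]≡n (ℕ.≤-pred (toℕ<n j))) l)))
                      (trans (sumFin-toℕ≡sumℕ (suc m) (λ t → h (m ∸ t))) (sumℕ-reverse m h)))))
        lemma : ∀ S → S + (+ 1 * (- S) + + 0) ≡ + 0
        lemma = solve-∀

    act-*P-charPoly : ∀ H s l → act s (H *P charPoly) l ≡ + 0
    act-*P-charPoly [] s l = refl
    act-*P-charPoly (c ∷ H) s l = trans (act-+P s (scale c charPoly) (+ 0 ∷ (H *P charPoly)) l)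
      (trans (cong₂ _+_ (trans (act-scale s c charPoly l) (trans (cong (c *_) (act-charPoly s l)) (ℤ.*-zeroʳ c)))
                        (trans (cong (_+ act (suc s) (H *P charPoly) l) (ℤ.*-zeroˡ (seq s l))) (trans (ℤ.+-identityˡ _) (act-*P-charPoly H (suc s) l))))
             refl)

    act-xⁿ-c : ∀ q r s l → act s (xⁿ-c q r) l ≡ seq (s ℕ.+ q) l - r * seq s l
    act-xⁿ-c q r s l rewrite xⁿ-c≡shift q r =
      trans (act-+P s (shift q (+ 1 ∷ [])) (- r ∷ []) l)
      (trans (cong (λ z → z + ((- r) * seq s l + + 0)) (act-shift s q (+ 1 ∷ []) l))
             (lemma (seq (s ℕ.+ q) l) r (seq s l)))
      where lemma : ∀ a r b → (+ 1 * a + + 0) + ((- r) * b + + 0) ≡ a - r * b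
            lemma = solve-∀

    det-congruence : ∀ q r H → xⁿ-c q r ≈ (H *P charPoly) → (detCompanion ^ q) ≡ₚ (r ^ suc m)
    det-congruence q r H xᵠ-r≈HG = mkₚ (subst p∣_ det-difference (det-cong-mod (suc m) (window q) (λ i l → r * identity i l) window-q≡rI))
      where
        seq-q≡r·seq : ∀ t l → p∣ (seq (t ℕ.+ q) l - r * seq t l)
        seq-q≡r·seq t l = subst p∣_ (trans (cong (λ z → act t (xⁿ-c q r) l - z) (act-*P-charPoly H t l))
                                           (trans (ℤ.+-identityʳ _) (act-xⁿ-c q r t l)))
                                    (act-≈ t l xᵠ-r≈HG)
        window-q≡rI : ∀ i l → p∣ (window q i l - r * identity i l)
        window-q≡rI i l = subst p∣_ (cong₂ (λ x y → x - r * y)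
                                           (sym (trans (window-row (m ∸ toℕ i) q i i+[m-i]≡m l) (cong (λ z → seq z l) (ℕ.+-comm q (m ∸ toℕ i)))))
                                           (sym (window-row (m ∸ toℕ i) 0 i i+[m-i]≡m l)))
                                    (seq-q≡r·seq (m ∸ toℕ i) l)
          where i+[m-i]≡m = ℕ.m+[n∸m]≡n (ℕ.≤-pred (toℕ<n i))
        det-difference : det (suc m) (window q) - det (suc m) (λ i l → r * identity i l) ≡ detCompanion ^ q - r ^ suc m
        det-difference = cong₂ _-_ (det-window q)
          (trans (det-scale (suc m) r identity) (trans (cong (r ^ suc m *_) (det-identity (suc m))) (ℤ.*-identityʳ _)))

  qthRoot-via-r⁻¹ : ∀ q d x y → 1 ℕ.+ x ℕ.* q ≡ y ℕ.* d → ∀ c r → ¬ p∣ r → c ^ q ≡ₚ r ^ d → Σ ℤ λ z → z ^ q ≡ₚ r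
  qthRoot-via-r⁻¹ q d x y 1+xq≡yd c r p∤r cᵠ≡rᵈ with inverse r p∤r
  ... | r⁻¹ , p∣r⁻¹r-1 = c ^ y * r⁻¹ ^ x , (begin
    (c ^ y * r⁻¹ ^ x) ^ q            ≡⟨ ^-distrib-* (c ^ y) (r⁻¹ ^ x) q ⟩
    (c ^ y) ^ q * (r⁻¹ ^ x) ^ q      ≡⟨ cong₂ _*_ (^-swap c y q) (ℤ.^-*-assoc r⁻¹ x q) ⟩
    (c ^ q) ^ y * r⁻¹ ^ (x ℕ.* q)    ≈⟨ ≡ₚ-* (≡ₚ-^ y cᵠ≡rᵈ) (≡ₚ-refl {r⁻¹ ^ (x ℕ.* q)}) ⟩
    (r ^ d) ^ y * r⁻¹ ^ (x ℕ.* q)    ≡⟨ cong (_* r⁻¹ ^ (x ℕ.* q)) (trans (ℤ.^-*-assoc r d y) (cong (r ^_) (trans (ℕ.*-comm d y) (sym 1+xq≡yd)))) ⟩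
    r * r ^ (x ℕ.* q) * r⁻¹ ^ (x ℕ.* q) ≡⟨ trans (ℤ.*-assoc r (r ^ (x ℕ.* q)) (r⁻¹ ^ (x ℕ.* q))) (cong (r *_) (sym (^-distrib-* r r⁻¹ (x ℕ.* q)))) ⟩
    r * (r * r⁻¹) ^ (x ℕ.* q)        ≈⟨ ≡ₚ-* (≡ₚ-refl {r}) (≡ₚ-^ (x ℕ.* q) (mkₚ (subst p∣_ (cong (_- + 1) (ℤ.*-comm r⁻¹ r)) p∣r⁻¹r-1))) ⟩
    r * (+ 1) ^ (x ℕ.* q)            ≡⟨ trans (cong (r *_) (ℤ.^-zeroˡ (x ℕ.* q))) (ℤ.*-identityʳ r) ⟩
    r                                ∎)
    where open ≡ₚ-Reasoning

  qthRoot-via-c⁻¹ : ∀ q d x y → 1 ℕ.+ y ℕ.* d ≡ x ℕ.* q → ∀ c r → ¬ p∣ c → c ^ q ≡ₚ r ^ d → Σ ℤ λ z → z ^ q ≡ₚ r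
  qthRoot-via-c⁻¹ q d x y 1+yd≡xq c r p∤c cᵠ≡rᵈ with inverse c p∤c
  ... | c⁻¹ , p∣c⁻¹c-1 = r ^ x * c⁻¹ ^ y , (begin
    (r ^ x * c⁻¹ ^ y) ^ q            ≡⟨ ^-distrib-* (r ^ x) (c⁻¹ ^ y) q ⟩
    (r ^ x) ^ q * (c⁻¹ ^ y) ^ q      ≡⟨ cong₂ _*_ (trans (ℤ.^-*-assoc r x q) (cong (r ^_) (sym 1+yd≡xq))) (^-swap c⁻¹ y q) ⟩
    r * r ^ (y ℕ.* d) * (c⁻¹ ^ q) ^ y ≡⟨ cong (λ z → r * z * (c⁻¹ ^ q) ^ y) (sym (trans (ℤ.^-*-assoc r d y) (cong (r ^_) (ℕ.*-comm d y)))) ⟩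
    r * (r ^ d) ^ y * (c⁻¹ ^ q) ^ y  ≈⟨ ≡ₚ-* (≡ₚ-* (≡ₚ-refl {r}) (≡ₚ-^ y (≡ₚ-sym cᵠ≡rᵈ))) (≡ₚ-refl {(c⁻¹ ^ q) ^ y}) ⟩
    r * (c ^ q) ^ y * (c⁻¹ ^ q) ^ y  ≡⟨ trans (ℤ.*-assoc r ((c ^ q) ^ y) ((c⁻¹ ^ q) ^ y)) (cong (r *_) (trans (sym (^-distrib-* (c ^ q) (c⁻¹ ^ q) y))
                                                                                (cong (_^ y) (sym (^-distrib-* c c⁻¹ q))))) ⟩
    r * ((c * c⁻¹) ^ q) ^ y          ≈⟨ ≡ₚ-* (≡ₚ-refl {r}) (≡ₚ-^ y (≡ₚ-^ q (mkₚ (subst p∣_ (cong (_- + 1) (ℤ.*-comm c⁻¹ c)) p∣c⁻¹c-1)))) ⟩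
    r * ((+ 1) ^ q) ^ y              ≡⟨ trans (cong (λ z → r * z ^ y) (ℤ.^-zeroˡ q)) (trans (cong (r *_) (ℤ.^-zeroˡ y)) (ℤ.*-identityʳ r)) ⟩
    r                                ∎)
    where open ≡ₚ-Reasoning

  qthRoot : ∀ q → Prime q → ∀ d → 0 ℕ.< d → d ℕ.< q → ∀ c r → ¬ p∣ r → c ^ q ≡ₚ r ^ d → Σ ℤ λ z → z ^ q ≡ₚ r
  qthRoot q q-prime d d>0 d<q c r p∤r cᵠ≡rᵈ with coprime-Bézout (prime⇒coprime q-prime {{ℕ.>-nonZero d>0}} d<q)
  ... | Bézout.-+ x y 1+xq≡yd = qthRoot-via-r⁻¹ q d x y 1+xq≡yd c r p∤r cᵠ≡rᵈ
  ... | Bézout.+- x y 1+yd≡xq = qthRoot-via-c⁻¹ q d x y 1+yd≡xq c r p∤c cᵠ≡rᵈ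
    where
      p∤c : ¬ p∣ c
      p∤c p∣c = p∤^ d p∤r (subst p∣_ (lemma (c ^ q) (r ^ d))
                                 (∣m∣n⇒∣m-n (p∣⇒p∣^ q {{prime⇒nonZero q-prime}} p∣c) (p∣- cᵠ≡rᵈ)))
        where lemma : ∀ a b → a - (a - b) ≡ b
              lemma = solve-∀

  monic-associate : ∀ m g → Deg< (suc (suc m)) g → ∀ e → p∣ (e * coeff g (suc m) - + 1) →
    g ≈ scale (coeff g (suc m)) (Annihilator.charPoly m (λ t → e * coeff g t))
  monic-associate m g Deg<-g e e-inverse = ≈-sym (≈-trans (≈-scale gₘ charPoly≈eg) (mk≈ λ t →
    subst p∣_ (sym (trans (cong (_- coeff g t) (trans (coeff-scale gₘ (scale e g) t) (cong (gₘ *_) (coeff-scale e g t))))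
                          (lemma gₘ e (coeff g t))))
              (∣m⇒∣m*n (coeff g t) e-inverse)))
    where
      gₘ = coeff g (suc m)
      a : ℕ → ℤ
      a t = e * coeff g t
      open Annihilator m a using (charPoly)
      lemma : ∀ d e x → d * (e * x) - x ≡ (e * d - + 1) * x
      lemma = solve-∀
      high : ∀ j → p∣ (coeff charPoly (suc m ℕ.+ j) - coeff (scale e g) (suc m ℕ.+ j))
      high zero    = subst p∣_ (sym (trans (cong₂ _-_ (coeff-fromSeq++-+ (suc m) a (+ 1 ∷ []) zero) (coeff-scale e g (suc m ℕ.+ 0)))
                                           (trans (cong (λ z → + 1 - e * coeff g z) (ℕ.+-identityʳ (suc m))) (lemma′ e gₘ))))
                               (∣m⇒∣-m e-inverse)
        where lemma′ : ∀ e g → + 1 - e * g ≡ - (e * g - + 1)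
              lemma′ = solve-∀
      high (suc j) = subst p∣_ (sym (trans (cong₂ _-_ (coeff-fromSeq++-+ (suc m) a (+ 1 ∷ []) (suc j)) (coeff-scale e g (suc m ℕ.+ suc j)))
                                           (ℤ.+-identityˡ _)))
                               (∣m⇒∣-m (∣n⇒∣m*n e (subst (λ z → p∣ coeff g z) (sym (ℕ.+-suc (suc m) j)) (p∣coeff-beyond Deg<-g j))))
      charPoly≈eg : charPoly ≈ scale e g
      charPoly≈eg = mk≈ λ t → coeff≡ t
        where
          coeff≡ : ∀ t → p∣ (coeff charPoly t - coeff (scale e g) t)
          coeff≡ t with t ℕ.<? suc m
          ... | yes t<m = subst p∣_ (sym (trans (cong₂ _-_ (coeff-fromSeq++-< (suc m) a (+ 1 ∷ []) t t<m) (coeff-scale e g t))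
                                                (ℤ.+-inverseʳ (a t)))) p∣0
          ... | no  t≮m = subst (λ z → p∣ (coeff charPoly z - coeff (scale e g) z)) (ℕ.m+[n∸m]≡n (ℕ.≮⇒≥ t≮m)) (high (t ∸ suc m))

  -- A factor g of xᵠ - r of degree m + 1 makes xᵠ ≡ r in 𝔽ₚ[x]/(g); on the companion matrix of g
  -- this reads Cᵠ ≡ r I, and taking determinants gives (det C)ᵠ ≡ r^(m+1).
  factor⇒qthRoot : ∀ q → Prime q → ∀ r → ¬ p∣ r → ∀ m g h → suc m ℕ.< q →
    Deg< (suc (suc m)) g → ¬ p∣ coeff g (suc m) → (g *P h) ≈ xⁿ-c q r → Σ ℤ λ z → z ^ q ≡ₚ r
  factor⇒qthRoot q q-prime r p∤r m g h m<q Deg<-g p∤gₘ gh≈xᵠ-r with inverse (coeff g (suc m)) p∤gₘ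
  ... | e , e-inverse = qthRoot q q-prime (suc m) (ℕ.s≤s ℕ.z≤n) m<q (Recurrence.detCompanion m a) r p∤r
                                (Annihilator.det-congruence m a q r (scale gₘ h) xᵠ-r≈hG)
    where
      gₘ = coeff g (suc m)
      a : ℕ → ℤ
      a t = e * coeff g t
      open Annihilator m a using (charPoly)
      xᵠ-r≈hG : xⁿ-c q r ≈ (scale gₘ h *P charPoly)
      xᵠ-r≈hG = ≈-trans (≈-sym gh≈xᵠ-r) (≈-trans (≈-*Pˡ h (monic-associate m g Deg<-g e e-inverse))
                  (≐⇒≈ (≐-trans (scale-*Pˡ gₘ charPoly h) (≐-trans (scale-cong gₘ (*P-comm charPoly h)) (≐-sym (scale-*Pˡ gₘ h charPoly))))))

  degree : ∀ g → NonConst g → Σ ℕ λ d → (1 ℕ.≤ d) × Deg< (suc d) g × ¬ p∣ coeff g d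
  degree g (k , k≥1 , p∤gₖ) with degree-or-p∣ᴾ (length g) g (Deg<-len g)
  ... | inj₁ p∣g = ⊥-elim (p∤gₖ (p∣coeff p∣g k))
  ... | inj₂ (d , _ , Deg<-g , p∤g_d) with k ℕ.≤? d
  ...   | yes k≤d = d , ℕ.≤-trans k≥1 k≤d , Deg<-g , p∤g_d
  ...   | no  k≰d = ⊥-elim (p∤gₖ (Deg<-at k (ℕ.≰⇒> k≰d) Deg<-g))

  xᵠ-r-noFactorisation : ∀ q → Prime q → ∀ r → ¬ (Σ ℤ λ y → y ^ q ≡ₚ r) →
    ∀ g h → (g *P h) ≈ xⁿ-c q r → ¬ (NonConst g × NonConst h)
  xᵠ-r-noFactorisation q q-prime r no-root g h gh≈xᵠ-r (g-nonConst , h-nonConst)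
    with degree g g-nonConst | degree h h-nonConst
  ... | d , d≥1 , Deg<-g , p∤g_d | e , e≥1 , Deg<-h , p∤h_e with (d ℕ.+ e) ℕ.≤? q
  ...   | no  d+e≰q = p∤* p∤g_d p∤h_e (subst p∣_ (lemma (coeff (g *P h) (d ℕ.+ e)) (coeff g d * coeff h e) (coeff (xⁿ-c q r) (d ℕ.+ e)))
                         (∣m∣n⇒∣m+n (∣m∣n⇒∣m-n (at≈ gh≈xᵠ-r (d ℕ.+ e)) (coeff-*P-top g d h e Deg<-g Deg<-h))
                                    (Deg<-at (d ℕ.+ e) (ℕ.≰⇒> d+e≰q) (Deg<-xⁿ-c q r))))
    where lemma : ∀ x y z → ((x - z) - (x - y)) + z ≡ y
          lemma = solve-∀
  ...   | yes d+e≤q with d | d≥1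
  ...     | zero  | ()
  ...     | suc m | _ = no-root (factor⇒qthRoot q q-prime r p∤r m g h d<q Deg<-g p∤g_d gh≈xᵠ-r)
    where
      d<q : suc m ℕ.< q
      d<q = ℕ.<-≤-trans (subst (ℕ._≤ suc m ℕ.+ e) (ℕ.+-comm (suc m) 1) (ℕ.+-monoʳ-≤ (suc m) e≥1)) d+e≤q
      p∤r : ¬ p∣ r
      p∤r p∣r = no-root (+ 0 , mkₚ (∣m∣n⇒∣m-n (p∣⇒p∣^ q {{prime⇒nonZero q-prime}} p∣0) p∣r))

  xᵠ-r-irreducible : ∀ q → Prime q → ∀ r → ¬ (∃ λ (y : ℤ) → (+ p) ∣ (y ^ q - r)) → IrreducibleMod p (xⁿ-c q r)
  xᵠ-r-irreducible q q-prime r no-root =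
    (q , q≥1 , λ p∣1 → p∤1 (subst p∣_ (coeff-xⁿ-c-n q r q≥1) (∣ᵤ⇒∣ p∣1))) ,
    λ g h gh≡xᵠ-r nonConst → xᵠ-r-noFactorisation q q-prime r (λ { (y , yᵠ≡r) → no-root (y , ∣⇒∣ᵤ (p∣- yᵠ≡r)) }) g h
                               (mk≈ λ k → ∣ᵤ⇒∣ (gh≡xᵠ-r k)) (NonConstMod⇒NonConst {g} (proj₁ nonConst) , NonConstMod⇒NonConst {h} (proj₂ nonConst))
    where
      q≥1 : 1 ℕ.≤ q
      q≥1 = ℕ.<⇒≤ (ℕ.nonTrivial⇒n>1 q {{prime⇒nonTrivial q-prime}})

theorem5p3 :
    (∀ (p : ℕ) → Prime p → (r r₀ : ℤ) → (+ p) ∣ (r - r₀) → (n : ℕ) → 2 ≤ n →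
      IrreducibleMod p (xⁿ-c n r₀) → (x : Fin n → ℤ) → D r n x ≢ + p)
    ×
    (∀ (p q : ℕ) → Prime p → Prime q → (r : ℤ) →
      ¬ (∃ λ (y : ℤ) → (+ p) ∣ (y ^ q - r)) → (x : Fin q → ℤ) → D r q x ≢ + p)
theorem5p3 = (λ p p-prime → NormModulo.D≢p p p-prime) , no-qth-root⇒D≢p
  where
    no-qth-root⇒D≢p : ∀ p q → Prime p → Prime q → ∀ r → ¬ (∃ λ y → (+ p) ∣ (y ^ q - r)) →
                      (x : Fin q → ℤ) → D r q x ≢ + p
    no-qth-root⇒D≢p p q p-prime q-prime r no-root =
      NormModulo.D≢p p p-prime r r (∣⇒∣ᵤ (Modulo.p∣x-x p p-prime r)) q
                     (ℕ.nonTrivial⇒n>1 q {{prime⇒nonTrivial q-prime}})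
                     (CompanionModulo.xᵠ-r-irreducible p p-prime q q-prime r no-root)
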